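{- Let $0\le k\le n$, $\sigma\in\mathcal{S}_k$, $\tau\in\mathcal{C}_{n-k}$, and $f=\mathrm{diag}(\sigma,\tau)$. Then the character of $o(f)$ factors as $$\chi_{o(f)}=\chi_{Z(\sigma),\mathcal{S}_k}\cdot\chi_{o(\tau)},$$ where $Z(\sigma)$ is the centralizer of $\sigma$ in $\mathcal{S}_k$.
   Context: $\mathcal{P}_n$ is the set of partial transformations of $[n]=\{1,\dots,n\}$ (maps $f\colon A\to[n]$, $A\subseteq[n]$), with composition $(fg)(i)=f(g(i))$ where defined; $\mathcal{S}_n$ acts on it by conjugation $f\mapsto \pi f\pi^{ -1}$. $\mathcal{C}_p$ is the set of nilpotent partial transformations of $[p]$ (some power is the empty map). For $\sigma\in\mathcal{S}_k$, $\tau\in\mathcal{P}_{n-k}$, $\mathrm{diag}(\sigma,\tau)\in\mathcal{P}_n$ acts as $\sigma$ on $\{1,\dots,k\}$, sends $k+j$ to $k+\tau(j)$ for $j\in\mathrm{dom}(\tau)$, and is undefined at $k+j$ for $j\notin\mathrm{dom}(\tau)$. For $g\in\mathcal{P}_p$, $o(g)$ is the permutation representation of $\mathcal{S}_p$ on the conjugation orbit $\{\pi g\pi^{ -1}:\pi\in\mathcal{S}_p\}$ (isomorphic to $\mathrm{Ind}_{\mathrm{Stab}_{\mathcal{S}_p}(g)}^{\mathcal{S}_p}\mathbf{1}$), with character $\chi_{o(g)}$. For a subgroup $H\subseteq G$, $\chi_{H,G}$ is the character of $\mathrm{Ind}_H^G\mathbf{1}$. For a character $\alpha$ of $\mathcal{S}_a$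 and $\beta$ of $\mathcal{S}_b$, $\alpha\cdot\beta$ denotes the character of $\mathrm{Ind}_{\mathcal{S}_a\times\mathcal{S}_b}^{\mathcal{S}_{a+b}}(\alpha\otimes\beta)$ (equivalently, its Frobenius characteristic is the product of those of $\alpha$ and $\beta$). -}

module Defs where

open import Data.Nat using (ℕ; zero; suc; _+_; _*_; _/_; _!)
open import Data.Fin using (Fin; splitAt; _↑ˡ_; _↑ʳ_; _≟_)
open import Data.Fin.Properties using (all?; any?)
open import Data.Maybe using (Maybe; just; nothing; _>>=_)
import Data.Maybe as Maybe
open import Data.Maybe.Properties using (≡-dec)
open import Data.Vec using (Vec; []; _∷_; lookup; tabulate; replicate)
open import Data.List using (List; []; _∷_; filter; length; map; concatMap)
open import Data.Nat.ListAction using (sum)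
open import Data.Sum using (inj₁; inj₂; [_,_])
open import Data.Bool using (if_then_else_)
open import Data.Product using (∃; Σ; _,_; _×_)
open import Relation.Binary.PropositionalEquality using (_≡_)
open import Relation.Nullary using (Dec; does)
open import Relation.Nullary.Decidable using (_×-dec_)
open import Relation.Unary using (Decidable)

allVecs : {A : Set} → List A → (n : ℕ) → List (Vec A n)
allVecs xs zero    = [] ∷ []
allVecs xs (suc n) = concatMap (λ x → map (x ∷_) (allVecs xs n)) xs

allFinList : (n : ℕ) → List (Fin n)
allFinList n = Data.List.allFin n

allMaybeFin : (n : ℕ) → List (Maybe (Fin n))
allMaybeFin n = nothing ∷ map just (allFinList n)

count : {A : Set} {P : A → Set} → Decidable P → List A → ℕ
count P? xs = length (filter P? xs)

-- division, with the (irrelevant here) convention a / 0 = 0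
_div_ : ℕ → ℕ → ℕ
a div zero    = 0
a div (suc b) = a / suc b

-- Symmetric group S_n: a map i ↦ lookup π i of [n] = Fin n, as a vector,
-- which is a permutation (surjective, hence bijective on a finite set).

IsPerm : {n : ℕ} → Vec (Fin n) n → Set
IsPerm {n} π = (i : Fin n) → ∃ λ j → lookup π j ≡ i

isPerm? : {n : ℕ} → Decidable (IsPerm {n})
isPerm? π = all? (λ i → any? (λ j → lookup π j ≟ i))

perms : (n : ℕ) → List (Vec (Fin n) n)
perms n = filter isPerm? (allVecs (allFinList n) n)

-- "g ∘ x = x ∘ y", i.e. x⁻¹ g x = y
ConjPerm : {n : ℕ} → (g x y : Vec (Fin n) n) → Set
ConjPerm {n} g x y = (i : Fin n) → lookup g (lookup x i) ≡ lookup x (lookup y i)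

conjPerm? : {n : ℕ} (g x y : Vec (Fin n) n) → Dec (ConjPerm g x y)
conjPerm? g x y = all? (λ i → lookup g (lookup x i) ≟ lookup x (lookup y i))

-- Partial transformations P_n : f i = just j means f(i) = j, nothing = undefined

PT : ℕ → Set
PT n = Vec (Maybe (Fin n)) n

allPT : (n : ℕ) → List (PT n)
allPT n = allVecs (allMaybeFin n) n

emptyPT : (n : ℕ) → PT n
emptyPT n = replicate n nothing

_∘PT_ : {n : ℕ} → PT n → PT n → PT n
f ∘PT g = tabulate (λ i → lookup g i >>= lookup f)

_^PT_ : {n : ℕ} → PT n → ℕ → PT n
_^PT_ {n} f zero    = tabulate just
f ^PT suc m         = f ∘PT (f ^PT m)

Nilpotent : {n : ℕ} → PT n → Set
Nilpotent {n} f = ∃ λ m → f ^PT m ≡ emptyPT n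

-- h = π f π⁻¹  (stated as h ∘ π = π ∘ f, π a permutation)
ConjPT : {n : ℕ} → (π : Vec (Fin n) n) → (f h : PT n) → Set
ConjPT {n} π f h = (j : Fin n) → lookup h (lookup π j) ≡ Maybe.map (lookup π) (lookup f j)

conjPT? : {n : ℕ} (π : Vec (Fin n) n) (f h : PT n) → Dec (ConjPT π f h)
conjPT? π f h = all? (λ j → ≡-dec _≟_ (lookup h (lookup π j)) (Maybe.map (lookup π) (lookup f j)))

InOrbit : {n : ℕ} → PT n → PT n → Set
InOrbit {n} g h = Data.List.Relation.Unary.Any.Any (λ ρ → ConjPT ρ g h) (perms n)
  where import Data.List.Relation.Unary.Any

inOrbit? : {n : ℕ} (g : PT n) → Decidable (InOrbit g)
inOrbit? {n} g h = Data.List.Relation.Unary.Any.any? (λ ρ → conjPT? ρ g h) (perms n)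
  where import Data.List.Relation.Unary.Any

-- character of o(g) at π: number of points h of the orbit fixed by π (π h π⁻¹ = h)
χo : (p : ℕ) → PT p → Vec (Fin p) p → ℕ
χo p g π = count (λ h → inOrbit? g h ×-dec conjPT? π h h) (allPT p)

-- χ_{H,G} for G = S_k and H ⊆ S_k given by a decidable predicate:
-- χ(g) = (1/|H|) · #{ x ∈ S_k : x⁻¹ g x ∈ H }
-- (x⁻¹ g x ∈ H  iff  some y ∈ H satisfies g ∘ x = x ∘ y)
χInd : (k : ℕ) {H : Vec (Fin k) k → Set} → Decidable H → Vec (Fin k) k → ℕ
χInd k {H} H? g =
  count (λ x → Data.List.Relation.Unary.Any.any? (λ y → H? y ×-dec conjPerm? g x y) (perms k)) (perms k)
  div count H? (perms k)
  where import Data.List.Relation.Unary.Any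

Centralizer : {k : ℕ} → Vec (Fin k) k → Vec (Fin k) k → Set
Centralizer {k} σ y = IsPerm y × ((i : Fin k) → lookup σ (lookup y i) ≡ lookup y (lookup σ i))

centralizer? : {k : ℕ} (σ : Vec (Fin k) k) → Decidable (Centralizer σ)
centralizer? σ y = isPerm? y ×-dec all? (λ i → lookup σ (lookup y i) ≟ lookup y (lookup σ i))

diagPerm : {a b : ℕ} → Vec (Fin a) a → Vec (Fin b) b → Vec (Fin (a + b)) (a + b)
diagPerm {a} {b} y₁ y₂ = tabulate λ i → [ (λ i₁ → lookup y₁ i₁ ↑ˡ b) , (λ i₂ → a ↑ʳ lookup y₂ i₂) ] (splitAt a i)

diag : {k m : ℕ} → Vec (Fin k) k → PT m → PT (k + m)
diag {k} {m} σ τ = tabulate λ i → [ (λ i₁ → just (lookup σ i₁ ↑ˡ m)) , (λ j → Maybe.map (k ↑ʳ_) (lookup τ j)) ] (splitAt k i)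

-- induction product α · β : character of Ind_{S_a × S_b}^{S_{a+b}} (α ⊗ β)
-- (α·β)(g) = (1/(a! b!)) Σ_{x ∈ S_{a+b}} Σ_{(y₁,y₂) ∈ S_a × S_b, x⁻¹ g x = diag(y₁,y₂)} α(y₁) β(y₂)
indProd : (a b : ℕ) → (Vec (Fin a) a → ℕ) → (Vec (Fin b) b → ℕ) → Vec (Fin (a + b)) (a + b) → ℕ
indProd a b α β g =
  sum (map (λ x → sum (map (λ y₁ → sum (map (λ y₂ →
         if does (conjPerm? g x (diagPerm y₁ y₂)) then α y₁ * β y₂ else 0)
       (perms b))) (perms a))) (perms (a + b)))
  div (a ! * b !)

-- By orbit–stabilizer, χ_{o(F)}(g) · |Stab F| = #{ρ ∈ S_n : ρ⁻¹ g ρ ∈ Stab F}.  For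
-- f = diag(σ, τ) with τ nilpotent, every power of f is defined on the first block while a
-- power of τ is empty, so a permutation commuting with f preserves both blocks; hence
-- Stab f = Z(σ) × Stab τ, embedded block-diagonally.  The induction product is a sum over
-- x ∈ S_{k+m} with x⁻¹ g x = diag(y₁, y₂).  Multiplying it by |Z(σ)| · |Stab τ| and applying
-- orbit–stabilizer in each block (Z(σ) is the stabilizer of σ regarded as a partial map)
-- turns it into k! m! · #{ρ : ρ⁻¹ g ρ ∈ Stab f} = k! m! · χ_{o(f)}(g) · |Stab f|.

module Submission where

open import Data.Bool using (if_then_else_)
open import Data.Empty using (⊥-elim)
open import Data.Fin using (Fin; zero; suc; _↑ˡ_; _↑ʳ_; splitAt; punchOut)
import Data.Fin.Permutation.Components as PC
import Data.Fin.Properties as Finₚ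
open import Data.List using (List; []; _∷_; _++_; map; concatMap; filter; length)
open import Data.List.Membership.Propositional using (_∈_; find; lose)
open import Data.List.Membership.Propositional.Properties using (∈-filter⁻)
open import Data.List.Properties using (map-tabulate; length-tabulate)
open import Data.List.Relation.Unary.Any using (Any; here; there; any?)
open import Data.Maybe using (Maybe; just; nothing; _>>=_)
import Data.Maybe as Maybe
import Data.Maybe.Properties as Maybeₚ
open import Data.Nat using (ℕ; zero; suc; _+_; _*_; _!; _≤_; z≤n; NonZero; >-nonZero)
open import Data.Nat.DivMod using (m*n/n≡m)
open import Data.Nat.ListAction using (sum)
open import Data.Nat.Properties
open import Algebra.Properties.CommutativeSemigroup +-commutativeSemigroup
  using () renaming (interchange to +-interchange)
open import Algebra.Properties.CommutativeSemigroup *-commutativeSemigroup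
  using () renaming (interchange to *-interchange)
open import Data.Nat.Solver using (module +-*-Solver)
open import Data.Product using (∃; _×_; _,_; proj₁; proj₂)
open import Data.Sum using (_⊎_; inj₁; inj₂; [_,_])
open import Data.Vec using (Vec; []; _∷_; lookup; tabulate)
import Data.Vec.Properties as Vecₚ
open import Function using (_∘_; id; _⇔_; mk⇔; Equivalence)
open import Function.Definitions using (Injective)
open import Relation.Binary.Definitions using (DecidableEquality)
open import Relation.Binary.PropositionalEquality hiding ([_])
open import Relation.Nullary using (Dec; yes; no; ¬_; does)
open import Relation.Nullary.Decidable using (_×-dec_)
open import Relation.Unary using (Decidable)

open import Defs

open ≡-Reasoning

𝟙 : ∀ {p} {P : Set p} → Dec P → ℕ
𝟙 (yes _) = 1
𝟙 (no _)  = 0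

𝟙-yes : ∀ {p} {P : Set p} (d : Dec P) → P → 𝟙 d ≡ 1
𝟙-yes (yes _) _ = refl
𝟙-yes (no ¬p) p = ⊥-elim (¬p p)

𝟙-no : ∀ {p} {P : Set p} (d : Dec P) → ¬ P → 𝟙 d ≡ 0
𝟙-no (yes p) ¬p = ⊥-elim (¬p p)
𝟙-no (no _)  _  = refl

𝟙-cong : ∀ {p q} {P : Set p} {Q : Set q} (d : Dec P) (e : Dec Q) →
         (P → Q) → (Q → P) → 𝟙 d ≡ 𝟙 e
𝟙-cong (yes _) (yes _) _ _ = refl
𝟙-cong (yes p) (no ¬q) f _ = ⊥-elim (¬q (f p))
𝟙-cong (no ¬p) (yes q) _ g = ⊥-elim (¬p (g q))
𝟙-cong (no _)  (no _)  _ _ = refl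

𝟙-cong⇔ : ∀ {p q} {P : Set p} {Q : Set q} (d : Dec P) (e : Dec Q) → P ⇔ Q → 𝟙 d ≡ 𝟙 e
𝟙-cong⇔ d e P⇔Q = 𝟙-cong d e (Equivalence.to P⇔Q) (Equivalence.from P⇔Q)

𝟙-× : ∀ {p q} {P : Set p} {Q : Set q} (d : Dec P) (e : Dec Q) (de : Dec (P × Q)) →
      𝟙 de ≡ 𝟙 d * 𝟙 e
𝟙-× (yes p) (yes q) de = 𝟙-yes de (p , q)
𝟙-× (yes _) (no ¬q) de = 𝟙-no de (¬q ∘ proj₂)
𝟙-× (no ¬p) _       de = 𝟙-no de (¬p ∘ proj₁)

𝟙*-cong : ∀ {p} {P : Set p} (d : Dec P) {a b : ℕ} → (P → a ≡ b) → 𝟙 d * a ≡ 𝟙 d * b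
𝟙*-cong (yes p) f = cong (1 *_) (f p)
𝟙*-cong (no _)  _ = refl

𝟙*≤ : ∀ {p} {P : Set p} (d : Dec P) a → 𝟙 d * a ≤ a
𝟙*≤ (yes _) a = ≤-reflexive (+-identityʳ a)
𝟙*≤ (no _)  _ = z≤n

if-does≡𝟙* : ∀ {p} {P : Set p} (d : Dec P) a → (if does d then a else 0) ≡ 𝟙 d * a
if-does≡𝟙* (yes _) a = sym (+-identityʳ a)
if-does≡𝟙* (no _)  _ = refl

private
  variable
    A B : Set

∑ : List A → (A → ℕ) → ℕ
∑ []       F = 0
∑ (x ∷ xs) F = F x + ∑ xs F

syntax ∑ L (λ x → F) = ∑[ x ∈ L ] F

sum-map≡∑ : (L : List A) (F : A → ℕ) → sum (map F L) ≡ ∑ L F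
sum-map≡∑ []      F = refl
sum-map≡∑ (x ∷ L) F = cong (F x +_) (sum-map≡∑ L F)

∑-cong-∈ : (L : List A) {F G : A → ℕ} → (∀ {x} → x ∈ L → F x ≡ G x) → ∑ L F ≡ ∑ L G
∑-cong-∈ []      _ = refl
∑-cong-∈ (x ∷ L) h = cong₂ _+_ (h (here refl)) (∑-cong-∈ L (h ∘ there))

∑-cong : (L : List A) {F G : A → ℕ} → (∀ x → F x ≡ G x) → ∑ L F ≡ ∑ L G
∑-cong L h = ∑-cong-∈ L (λ {x} _ → h x)

∑-zero-∈ : (L : List A) {F : A → ℕ} → (∀ {x} → x ∈ L → F x ≡ 0) → ∑ L F ≡ 0
∑-zero-∈ []      _ = refl
∑-zero-∈ (x ∷ L) h = cong₂ _+_ (h (here refl)) (∑-zero-∈ L (h ∘ there))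

∑-zero : (L : List A) {F : A → ℕ} → (∀ x → F x ≡ 0) → ∑ L F ≡ 0
∑-zero L h = ∑-zero-∈ L (λ {x} _ → h x)

∑-mono : (L : List A) {F G : A → ℕ} → (∀ x → F x ≤ G x) → ∑ L F ≤ ∑ L G
∑-mono []      _ = z≤n
∑-mono (x ∷ L) h = +-mono-≤ (h x) (∑-mono L h)

∑-++ : (L M : List A) (F : A → ℕ) → ∑ (L ++ M) F ≡ ∑ L F + ∑ M F
∑-++ []      M F = refl
∑-++ (x ∷ L) M F = trans (cong (F x +_) (∑-++ L M F)) (sym (+-assoc (F x) _ _))

∑-+ : (L : List A) (F G : A → ℕ) → ∑[ x ∈ L ] (F x + G x) ≡ ∑ L F + ∑ L G
∑-+ []      F G = refl
∑-+ (x ∷ L) F G = trans (cong (F x + G x +_) (∑-+ L F G)) (+-interchange (F x) (G x) _ _)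

∑-*ˡ : (L : List A) (c : ℕ) (F : A → ℕ) → ∑[ x ∈ L ] (c * F x) ≡ c * ∑ L F
∑-*ˡ []      c F = sym (*-zeroʳ c)
∑-*ˡ (x ∷ L) c F = trans (cong (c * F x +_) (∑-*ˡ L c F)) (sym (*-distribˡ-+ c (F x) _))

∑-*ʳ : (L : List A) (c : ℕ) (F : A → ℕ) → ∑[ x ∈ L ] (F x * c) ≡ ∑ L F * c
∑-*ʳ L c F = trans (∑-cong L (λ x → *-comm (F x) c)) (trans (∑-*ˡ L c F) (*-comm c _))

∑-filter : {P : A → Set} (P? : Decidable P) (L : List A) (F : A → ℕ) →
           ∑ (filter P? L) F ≡ ∑[ x ∈ L ] (𝟙 (P? x) * F x)
∑-filter P? []      F = refl
∑-filter P? (x ∷ L) F with P? x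
... | yes _ = cong₂ _+_ (sym (+-identityʳ (F x))) (∑-filter P? L F)
... | no _  = ∑-filter P? L F

count≡∑𝟙 : {P : A → Set} (P? : Decidable P) (L : List A) → count P? L ≡ ∑[ x ∈ L ] 𝟙 (P? x)
count≡∑𝟙 P? []      = refl
count≡∑𝟙 P? (x ∷ L) with P? x
... | yes _ = cong suc (count≡∑𝟙 P? L)
... | no _  = count≡∑𝟙 P? L

∑-map : (g : A → B) (L : List A) (F : B → ℕ) → ∑ (map g L) F ≡ ∑ L (F ∘ g)
∑-map g []      F = refl
∑-map g (x ∷ L) F = cong (F (g x) +_) (∑-map g L F)

∑-concatMap : (g : A → List B) (L : List A) (F : B → ℕ) →
              ∑ (concatMap g L) F ≡ ∑[ x ∈ L ] ∑ (g x) F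
∑-concatMap g []      F = refl
∑-concatMap g (x ∷ L) F =
  trans (∑-++ (g x) (concatMap g L) F) (cong (∑ (g x) F +_) (∑-concatMap g L F))

∑-swap : (L : List A) (M : List B) (F : A → B → ℕ) →
         ∑[ x ∈ L ] ∑[ y ∈ M ] F x y ≡ ∑[ y ∈ M ] ∑[ x ∈ L ] F x y
∑-swap []      M F = sym (∑-zero M (λ _ → refl))
∑-swap (x ∷ L) M F = trans (cong (∑ M (F x) +_) (∑-swap L M F)) (sym (∑-+ M (F x) _))

∑-const : (L : List A) (c : ℕ) → ∑[ _ ∈ L ] c ≡ length L * c
∑-const []      c = refl
∑-const (x ∷ L) c = cong (c +_) (∑-const L c)

∑-one : (L : List A) → ∑[ _ ∈ L ] 1 ≡ length L
∑-one []      = refl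
∑-one (x ∷ L) = cong suc (∑-one L)

∑*∑ : (L : List A) (M : List B) (F : A → ℕ) (G : B → ℕ) →
      ∑ L F * ∑ M G ≡ ∑[ x ∈ L ] ∑[ y ∈ M ] (F x * G y)
∑*∑ L M F G = trans (sym (∑-*ʳ L (∑ M G) F)) (∑-cong L (λ x → sym (∑-*ˡ M (F x) G)))

multiplicity : DecidableEquality A → List A → A → ℕ
multiplicity _≟_ L a = ∑[ b ∈ L ] 𝟙 (b ≟ a)

∑-onePoint : (_≟_ : DecidableEquality A) (L : List A) (a : A) (G : A → ℕ) →
             ∑[ b ∈ L ] (𝟙 (b ≟ a) * G b) ≡ multiplicity _≟_ L a * G a
∑-onePoint _≟_ L a G =
  trans (∑-cong L (λ b → 𝟙*-cong (b ≟ a) (cong G))) (∑-*ʳ L (G a) (λ b → 𝟙 (b ≟ a)))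

multiplicity≢0⇒∈ : (_≟_ : DecidableEquality A) (L : List A) (a : A) →
                   multiplicity _≟_ L a ≢ 0 → a ∈ L
multiplicity≢0⇒∈ _≟_ []      a m≢0 = ⊥-elim (m≢0 refl)
multiplicity≢0⇒∈ _≟_ (x ∷ L) a m≢0 with x ≟ a
... | yes refl = here refl
... | no _     = there (multiplicity≢0⇒∈ _≟_ L a m≢0)

multiplicity-map : (_≟ᴬ_ : DecidableEquality A) (_≟ᴮ_ : DecidableEquality B) {g : A → B} →
                   Injective _≡_ _≡_ g → (L : List A) (a : A) →
                   multiplicity _≟ᴮ_ (map g L) (g a) ≡ multiplicity _≟ᴬ_ L a
multiplicity-map _≟ᴬ_ _≟ᴮ_ {g} g-inj L a =
  trans (∑-map g L _) (∑-cong L (λ b → 𝟙-cong (g b ≟ᴮ g a) (b ≟ᴬ a) g-inj (cong g)))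

multiplicity-map-∉ : (_≟_ : DecidableEquality B) (g : A → B) (L : List A) {b : B} →
                     (∀ a → g a ≢ b) → multiplicity _≟_ (map g L) b ≡ 0
multiplicity-map-∉ _≟_ g L {b} g≢b =
  trans (∑-map g L _) (∑-zero L (λ a → 𝟙-no (g a ≟ b) (g≢b a)))

IsEnumeration : DecidableEquality A → List A → Set
IsEnumeration _≟_ L = ∀ a → multiplicity _≟_ L a ≡ 1

∑-enumeration-onePoint : (_≟_ : DecidableEquality A) (L : List A) → IsEnumeration _≟_ L →
                         (a : A) (G : A → ℕ) → ∑[ b ∈ L ] (𝟙 (b ≟ a) * G b) ≡ G a
∑-enumeration-onePoint _≟_ L enum a G =
  trans (∑-onePoint _≟_ L a G) (trans (cong (_* G a) (enum a)) (*-identityˡ (G a)))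

_≟ᶠ_ : ∀ {n} → DecidableEquality (Fin n)
_≟ᶠ_ = Finₚ._≟_

_≟ᵐ_ : ∀ {n} → DecidableEquality (Maybe (Fin n))
_≟ᵐ_ = Maybeₚ.≡-dec _≟ᶠ_

_≟ᵖ_ : ∀ {n} → DecidableEquality (Vec (Fin n) n)
_≟ᵖ_ = Vecₚ.≡-dec _≟ᶠ_

_≟ᵗ_ : ∀ {n} → DecidableEquality (PT n)
_≟ᵗ_ = Vecₚ.≡-dec _≟ᵐ_

allFin-isEnumeration : ∀ n → IsEnumeration _≟ᶠ_ (allFinList n)
allFin-isEnumeration (suc n) i =
  trans (cong (λ L → multiplicity _≟ᶠ_ L i) (cong (zero ∷_) (sym (map-tabulate id suc))))
        (enum i)
  where
  enum : IsEnumeration _≟ᶠ_ (zero ∷ map suc (allFinList n))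
  enum zero    = cong suc (multiplicity-map-∉ _≟ᶠ_ suc (allFinList n) (λ _ ()))
  enum (suc j) = trans (multiplicity-map _≟ᶠ_ _≟ᶠ_ Finₚ.suc-injective (allFinList n) j)
                       (allFin-isEnumeration n j)

allMaybeFin-isEnumeration : ∀ n → IsEnumeration _≟ᵐ_ (allMaybeFin n)
allMaybeFin-isEnumeration n nothing =
  cong suc (multiplicity-map-∉ _≟ᵐ_ just (allFinList n) (λ _ ()))
allMaybeFin-isEnumeration n (just i) =
  trans (multiplicity-map _≟ᶠ_ _≟ᵐ_ Maybeₚ.just-injective (allFinList n) i)
        (allFin-isEnumeration n i)

allVecs-isEnumeration : (_≟_ : DecidableEquality A) (xs : List A) → IsEnumeration _≟_ xs →
                        ∀ n → IsEnumeration (Vecₚ.≡-dec _≟_) (allVecs xs n)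
allVecs-isEnumeration _≟_ xs enum zero    []       = refl
allVecs-isEnumeration _≟_ xs enum (suc n) (v ∷ vs) = begin
  multiplicity _≟ⱽ_ (concatMap (λ x → map (x ∷_) (allVecs xs n)) xs) (v ∷ vs)
    ≡⟨ ∑-concatMap (λ x → map (x ∷_) (allVecs xs n)) xs _ ⟩
  ∑[ x ∈ xs ] multiplicity _≟ⱽ_ (map (x ∷_) (allVecs xs n)) (v ∷ vs)
    ≡⟨ ∑-cong xs (λ x → trans (∑-map (x ∷_) (allVecs xs n) _)
                              (∑-cong (allVecs xs n) (𝟙-∷ x))) ⟩
  ∑[ x ∈ xs ] ∑[ w ∈ allVecs xs n ] (𝟙 (x ≟ v) * 𝟙 (w ≟ⱽ vs))
    ≡⟨ ∑-cong xs (λ x → ∑-*ˡ (allVecs xs n) (𝟙 (x ≟ v)) _) ⟩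
  ∑[ x ∈ xs ] (𝟙 (x ≟ v) * multiplicity _≟ⱽ_ (allVecs xs n) vs)
    ≡⟨ ∑-enumeration-onePoint _≟_ xs enum v (λ _ → multiplicity _≟ⱽ_ (allVecs xs n) vs) ⟩
  multiplicity _≟ⱽ_ (allVecs xs n) vs
    ≡⟨ allVecs-isEnumeration _≟_ xs enum n vs ⟩
  1 ∎
  where
  _≟ⱽ_ : ∀ {m} → DecidableEquality (Vec _ m)
  _≟ⱽ_ = Vecₚ.≡-dec _≟_
  𝟙-∷ : ∀ x w → 𝟙 ((x ∷ w) ≟ⱽ (v ∷ vs)) ≡ 𝟙 (x ≟ v) * 𝟙 (w ≟ⱽ vs)
  𝟙-∷ x w = trans (𝟙-cong ((x ∷ w) ≟ⱽ (v ∷ vs)) ((x ≟ v) ×-dec (w ≟ⱽ vs))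
                          Vecₚ.∷-injective (λ { (refl , refl) → refl }))
                  (𝟙-× (x ≟ v) (w ≟ⱽ vs) _)

allPT-isEnumeration : ∀ n → IsEnumeration _≟ᵗ_ (allPT n)
allPT-isEnumeration n = allVecs-isEnumeration _≟ᵐ_ (allMaybeFin n) (allMaybeFin-isEnumeration n) n

multiplicity-perms : ∀ n (x : Vec (Fin n) n) → multiplicity _≟ᵖ_ (perms n) x ≡ 𝟙 (isPerm? x)
multiplicity-perms n x = begin
  multiplicity _≟ᵖ_ (filter isPerm? vecs) x
    ≡⟨ ∑-filter isPerm? vecs _ ⟩
  ∑[ b ∈ vecs ] (𝟙 (isPerm? b) * 𝟙 (b ≟ᵖ x))
    ≡⟨ ∑-cong vecs (λ b → *-comm (𝟙 (isPerm? b)) _) ⟩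
  ∑[ b ∈ vecs ] (𝟙 (b ≟ᵖ x) * 𝟙 (isPerm? b))
    ≡⟨ ∑-enumeration-onePoint _≟ᵖ_ vecs (allVecs-isEnumeration _≟ᶠ_ (allFinList n) (allFin-isEnumeration n) n)
                               x (λ b → 𝟙 (isPerm? b)) ⟩
  𝟙 (isPerm? x) ∎
  where
  vecs : List (Vec (Fin n) n)
  vecs = allVecs (allFinList n) n

∈perms⇒IsPerm : ∀ {n} {x : Vec (Fin n) n} → x ∈ perms n → IsPerm x
∈perms⇒IsPerm {n} x∈ = proj₂ (∈-filter⁻ isPerm? {xs = allVecs (allFinList n) n} x∈)

IsPerm⇒∈perms : ∀ {n} {x : Vec (Fin n) n} → IsPerm x → x ∈ perms n
IsPerm⇒∈perms {n} {x} px = multiplicity≢0⇒∈ _≟ᵖ_ (perms n) x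
  (λ m≡0 → 1+n≢0 {0} (trans (sym (trans (multiplicity-perms n x) (𝟙-yes (isPerm? x) px))) m≡0))

Perm : ℕ → Set
Perm n = Vec (Fin n) n

lookup-ext : ∀ {n} {u v : Vec A n} → (∀ i → lookup u i ≡ lookup v i) → u ≡ v
lookup-ext {u = u} {v} h =
  trans (sym (Vecₚ.tabulate∘lookup u)) (trans (Vecₚ.tabulate-cong h) (Vecₚ.tabulate∘lookup v))

-- If f i ≡ f j with i ≢ j, redirecting r from j to i gives a right inverse avoiding j,
-- hence (after punching out j) an injection Fin (suc n) → Fin n.
rightInverse⇒injective : ∀ {n} {f r : Fin n → Fin n} → (∀ i → f (r i) ≡ i) →
                         Injective _≡_ _≡_ f
rightInverse⇒injective {zero}  _ {()}
rightInverse⇒injective {suc n} {f} {r} fr≗id {i} {j} fi≡fj with i ≟ᶠ j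
... | yes i≡j = i≡j
... | no  i≢j = ⊥-elim (<-irrefl refl (Finₚ.injective⇒≤ r″-injective))
  where
  r′ : Fin (suc n) → Fin (suc n)
  r′ t with r t ≟ᶠ j
  ... | yes _ = i
  ... | no  _ = r t
  fr′≗id : ∀ t → f (r′ t) ≡ t
  fr′≗id t with r t ≟ᶠ j
  ... | yes rt≡j = trans fi≡fj (trans (cong f (sym rt≡j)) (fr≗id t))
  ... | no  _    = fr≗id t
  j≢r′ : ∀ t → j ≢ r′ t
  j≢r′ t with r t ≟ᶠ j
  ... | yes _    = i≢j ∘ sym
  ... | no  rt≢j = rt≢j ∘ sym
  r″-injective : Injective _≡_ _≡_ (λ t → punchOut (j≢r′ t))
  r″-injective {t} {t′} eq = trans (sym (fr′≗id t))
    (trans (cong f (Finₚ.punchOut-injective (j≢r′ t) (j≢r′ t′) eq)) (fr′≗id t′))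

preimage : ∀ {n} → Perm n → Fin n → Fin n
preimage x i with Finₚ.any? (λ j → lookup x j ≟ᶠ i)
... | yes (j , _) = j
... | no  _       = i

lookup-preimage : ∀ {n} (x : Perm n) → IsPerm x → ∀ i → lookup x (preimage x i) ≡ i
lookup-preimage x px i with Finₚ.any? (λ j → lookup x j ≟ᶠ i)
... | yes (_ , xj≡i) = xj≡i
... | no  ∄j         = ⊥-elim (∄j (px i))

IsPerm⇒injective : ∀ {n} (x : Perm n) → IsPerm x → Injective _≡_ _≡_ (lookup x)
IsPerm⇒injective x px = rightInverse⇒injective (lookup-preimage x px)

idₚ : ∀ n → Perm n
idₚ n = tabulate id

infixl 7 _∘ₚ_
_∘ₚ_ : ∀ {n} → Perm n → Perm n → Perm n
x ∘ₚ y = tabulate (lookup x ∘ lookup y)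

_⁻¹ : ∀ {n} → Perm n → Perm n
x ⁻¹ = tabulate (preimage x)

conj : ∀ {n} → Perm n → Perm n → Perm n
conj ρ g = ρ ⁻¹ ∘ₚ (g ∘ₚ ρ)

module _ {n : ℕ} where

  lookup-∘ₚ : (x y : Perm n) (i : Fin n) → lookup (x ∘ₚ y) i ≡ lookup x (lookup y i)
  lookup-∘ₚ x y = Vecₚ.lookup∘tabulate (lookup x ∘ lookup y)

  lookup-⁻¹ʳ : (x : Perm n) → IsPerm x → ∀ i → lookup x (lookup (x ⁻¹) i) ≡ i
  lookup-⁻¹ʳ x px i = trans (cong (lookup x) (Vecₚ.lookup∘tabulate (preimage x) i))
                            (lookup-preimage x px i)

  lookup-⁻¹ˡ : (x : Perm n) → IsPerm x → ∀ i → lookup (x ⁻¹) (lookup x i) ≡ i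
  lookup-⁻¹ˡ x px i = IsPerm⇒injective x px (lookup-⁻¹ʳ x px (lookup x i))

  lookup-conj : (ρ g : Perm n) (i : Fin n) →
                lookup (conj ρ g) i ≡ lookup (ρ ⁻¹) (lookup g (lookup ρ i))
  lookup-conj ρ g i = trans (lookup-∘ₚ (ρ ⁻¹) (g ∘ₚ ρ) i) (cong (lookup (ρ ⁻¹)) (lookup-∘ₚ g ρ i))

  ⁻¹-∘ₚ-cancelˡ : (x : Perm n) → IsPerm x → (y : Perm n) → x ⁻¹ ∘ₚ (x ∘ₚ y) ≡ y
  ⁻¹-∘ₚ-cancelˡ x px y = lookup-ext λ i → trans (lookup-∘ₚ (x ⁻¹) (x ∘ₚ y) i)
    (trans (cong (lookup (x ⁻¹)) (lookup-∘ₚ x y i)) (lookup-⁻¹ˡ x px _))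

  ∘ₚ-⁻¹-cancelˡ : (x : Perm n) → IsPerm x → (y : Perm n) → x ∘ₚ (x ⁻¹ ∘ₚ y) ≡ y
  ∘ₚ-⁻¹-cancelˡ x px y = lookup-ext λ i → trans (lookup-∘ₚ x (x ⁻¹ ∘ₚ y) i)
    (trans (cong (lookup x) (lookup-∘ₚ (x ⁻¹) y i)) (lookup-⁻¹ʳ x px _))

  ∘ₚ-⁻¹-cancelʳ : (x : Perm n) → IsPerm x → (y : Perm n) → y ∘ₚ x ∘ₚ x ⁻¹ ≡ y
  ∘ₚ-⁻¹-cancelʳ x px y = lookup-ext λ i → trans (lookup-∘ₚ (y ∘ₚ x) (x ⁻¹) i)
    (trans (lookup-∘ₚ y x _) (cong (lookup y) (lookup-⁻¹ʳ x px i)))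

  ⁻¹-∘ₚ-cancelʳ : (x : Perm n) → IsPerm x → (y : Perm n) → y ∘ₚ x ⁻¹ ∘ₚ x ≡ y
  ⁻¹-∘ₚ-cancelʳ x px y = lookup-ext λ i → trans (lookup-∘ₚ (y ∘ₚ x ⁻¹) x i)
    (trans (lookup-∘ₚ y (x ⁻¹) _) (cong (lookup y) (lookup-⁻¹ˡ x px i)))

  idₚ-isPerm : IsPerm (idₚ n)
  idₚ-isPerm i = i , Vecₚ.lookup∘tabulate id i

  ∘ₚ-isPerm : (x y : Perm n) → IsPerm x → IsPerm y → IsPerm (x ∘ₚ y)
  ∘ₚ-isPerm x y px py i =
    let (a , xa≡i) = px i ; (b , yb≡a) = py a
    in b , trans (lookup-∘ₚ x y b) (trans (cong (lookup x) yb≡a) xa≡i)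

  ⁻¹-isPerm : (x : Perm n) → IsPerm x → IsPerm (x ⁻¹)
  ⁻¹-isPerm x px j = lookup x j , lookup-⁻¹ˡ x px j

  conj-isPerm : (ρ g : Perm n) → IsPerm ρ → IsPerm g → IsPerm (conj ρ g)
  conj-isPerm ρ g pρ pg = ∘ₚ-isPerm (ρ ⁻¹) (g ∘ₚ ρ) (⁻¹-isPerm ρ pρ) (∘ₚ-isPerm g ρ pg pρ)

  ConjPerm⇒≡conj : (g x y : Perm n) → IsPerm x → ConjPerm g x y → y ≡ conj x g
  ConjPerm⇒≡conj g x y px gx≡xy = lookup-ext λ i → sym (begin
    lookup (conj x g) i               ≡⟨ lookup-conj x g i ⟩
    lookup (x ⁻¹) (lookup g (lookup x i)) ≡⟨ cong (lookup (x ⁻¹)) (gx≡xy i) ⟩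
    lookup (x ⁻¹) (lookup x (lookup y i)) ≡⟨ lookup-⁻¹ˡ x px _ ⟩
    lookup y i                        ∎)

  ConjPerm-conj : (g x : Perm n) → IsPerm x → ConjPerm g x (conj x g)
  ConjPerm-conj g x px i = sym (trans (cong (lookup x) (lookup-conj x g i)) (lookup-⁻¹ʳ x px _))

  conj-∘ₚ : (ρ d g : Perm n) → IsPerm ρ → IsPerm d → conj d (conj ρ g) ≡ conj (ρ ∘ₚ d) g
  conj-∘ₚ ρ d g pρ pd = ConjPerm⇒≡conj g (ρ ∘ₚ d) (conj d (conj ρ g)) (∘ₚ-isPerm ρ d pρ pd) λ i →
    begin
      lookup g (lookup (ρ ∘ₚ d) i)                 ≡⟨ cong (lookup g) (lookup-∘ₚ ρ d i) ⟩
      lookup g (lookup ρ (lookup d i))             ≡⟨ ConjPerm-conj g ρ pρ (lookup d i) ⟩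
      lookup ρ (lookup (conj ρ g) (lookup d i))    ≡⟨ cong (lookup ρ) (ConjPerm-conj (conj ρ g) d pd i) ⟩
      lookup ρ (lookup d (lookup (conj d (conj ρ g)) i)) ≡⟨ lookup-∘ₚ ρ d _ ⟨
      lookup (ρ ∘ₚ d) (lookup (conj d (conj ρ g)) i) ∎

module _ (n : ℕ) where

  ∑-perms-cong : {F G : Perm n → ℕ} → (∀ x → IsPerm x → F x ≡ G x) →
                 ∑ (perms n) F ≡ ∑ (perms n) G
  ∑-perms-cong F≗G = ∑-cong-∈ (perms n) (λ x∈ → F≗G _ (∈perms⇒IsPerm x∈))

  ∑-perms-zero : {F : Perm n → ℕ} → (∀ x → IsPerm x → F x ≡ 0) → ∑ (perms n) F ≡ 0
  ∑-perms-zero F≗0 = ∑-zero-∈ (perms n) (λ x∈ → F≗0 _ (∈perms⇒IsPerm x∈))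

  ∑-perms-onePoint : (a : Perm n) → IsPerm a → (G : Perm n → ℕ) →
                     ∑[ b ∈ perms n ] (𝟙 (b ≟ᵖ a) * G b) ≡ G a
  ∑-perms-onePoint a pa G = begin
    ∑[ b ∈ perms n ] (𝟙 (b ≟ᵖ a) * G b)      ≡⟨ ∑-onePoint _≟ᵖ_ (perms n) a G ⟩
    multiplicity _≟ᵖ_ (perms n) a * G a      ≡⟨ cong (_* G a) (multiplicity-perms n a) ⟩
    𝟙 (isPerm? a) * G a                      ≡⟨ cong (_* G a) (𝟙-yes (isPerm? a) pa) ⟩
    1 * G a                                  ≡⟨ *-identityˡ (G a) ⟩
    G a                                      ∎

  term≤∑-perms : (a : Perm n) → IsPerm a → (F : Perm n → ℕ) → F a ≤ ∑ (perms n) F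
  term≤∑-perms a pa F = subst (_≤ ∑ (perms n) F) (∑-perms-onePoint a pa F)
                              (∑-mono (perms n) (λ b → 𝟙*≤ (b ≟ᵖ a) (F b)))

  ∑-perms-reindex : (φ ψ : Perm n → Perm n) →
                    (∀ x → IsPerm x → IsPerm (φ x)) → (∀ x → IsPerm x → IsPerm (ψ x)) →
                    (∀ x → IsPerm x → ψ (φ x) ≡ x) → (∀ x → IsPerm x → φ (ψ x) ≡ x) →
                    (F : Perm n → ℕ) → ∑ (perms n) (F ∘ φ) ≡ ∑ (perms n) F
  ∑-perms-reindex φ ψ pφ pψ ψφ φψ F = begin
    ∑[ x ∈ perms n ] F (φ x)
      ≡⟨ ∑-perms-cong (λ x px → sym (∑-perms-onePoint (φ x) (pφ x px) F)) ⟩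
    ∑[ x ∈ perms n ] ∑[ b ∈ perms n ] (𝟙 (b ≟ᵖ φ x) * F b)
      ≡⟨ ∑-swap (perms n) (perms n) _ ⟩
    ∑[ b ∈ perms n ] ∑[ x ∈ perms n ] (𝟙 (b ≟ᵖ φ x) * F b)
      ≡⟨ ∑-perms-cong (λ b pb → ∑-perms-cong (λ x px → cong (_* F b)
           (𝟙-cong (b ≟ᵖ φ x) (x ≟ᵖ ψ b) (λ b≡φx → trans (sym (ψφ x px)) (cong ψ (sym b≡φx)))
                                         (λ x≡ψb → trans (sym (φψ b pb)) (cong φ (sym x≡ψb)))))) ⟩
    ∑[ b ∈ perms n ] ∑[ x ∈ perms n ] (𝟙 (x ≟ᵖ ψ b) * F b)
      ≡⟨ ∑-perms-cong (λ b pb → ∑-perms-onePoint (ψ b) (pψ b pb) (λ _ → F b)) ⟩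
    ∑[ b ∈ perms n ] F b
      ∎

  ∑-perms-∘ₚʳ : (d : Perm n) → IsPerm d → (F : Perm n → ℕ) →
                ∑[ x ∈ perms n ] F (x ∘ₚ d) ≡ ∑ (perms n) F
  ∑-perms-∘ₚʳ d pd = ∑-perms-reindex (_∘ₚ d) (_∘ₚ d ⁻¹)
    (λ x px → ∘ₚ-isPerm x d px pd) (λ x px → ∘ₚ-isPerm x (d ⁻¹) px (⁻¹-isPerm d pd))
    (λ x _ → ∘ₚ-⁻¹-cancelʳ d pd x) (λ x _ → ⁻¹-∘ₚ-cancelʳ d pd x)

  ∑-perms-∘ₚˡ : (d : Perm n) → IsPerm d → (F : Perm n → ℕ) →
                ∑[ x ∈ perms n ] F (d ∘ₚ x) ≡ ∑ (perms n) F
  ∑-perms-∘ₚˡ d pd = ∑-perms-reindex (d ∘ₚ_) (d ⁻¹ ∘ₚ_)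
    (λ x px → ∘ₚ-isPerm d x pd px) (λ x px → ∘ₚ-isPerm (d ⁻¹) x (⁻¹-isPerm d pd) px)
    (λ x _ → ⁻¹-∘ₚ-cancelˡ d pd x) (λ x _ → ∘ₚ-⁻¹-cancelˡ d pd x)

-- The conjugation action of S_n on partial transformations

act : ∀ {n} → Perm n → PT n → PT n
act ρ F = tabulate (λ i → Maybe.map (lookup ρ) (lookup F (lookup (ρ ⁻¹) i)))

Stabilizes : ∀ {n} → PT n → Perm n → Set
Stabilizes F s = ConjPT s F F

stabilizerSize : ∀ n → PT n → ℕ
stabilizerSize n F = ∑[ s ∈ perms n ] 𝟙 (conjPT? s F F)

module _ {n : ℕ} where

  ConjPT-act : (ρ : Perm n) → IsPerm ρ → (F : PT n) → ConjPT ρ F (act ρ F)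
  ConjPT-act ρ pρ F j =
    trans (Vecₚ.lookup∘tabulate _ (lookup ρ j))
          (cong (Maybe.map (lookup ρ) ∘ lookup F) (lookup-⁻¹ˡ ρ pρ j))

  ConjPT⇒≡act : (ρ : Perm n) → IsPerm ρ → (F h : PT n) → ConjPT ρ F h → h ≡ act ρ F
  ConjPT⇒≡act ρ pρ F h ρF≡hρ = lookup-ext λ i → begin
    lookup h i                                         ≡⟨ cong (lookup h) (lookup-⁻¹ʳ ρ pρ i) ⟨
    lookup h (lookup ρ (lookup (ρ ⁻¹) i))              ≡⟨ ρF≡hρ _ ⟩
    Maybe.map (lookup ρ) (lookup F (lookup (ρ ⁻¹) i))  ≡⟨ Vecₚ.lookup∘tabulate _ i ⟨
    lookup (act ρ F) i                                 ∎

  ConjPT-idₚ : (F : PT n) → ConjPT (idₚ n) F F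
  ConjPT-idₚ F j = begin
    lookup F (lookup (idₚ n) j)               ≡⟨ cong (lookup F) (Vecₚ.lookup∘tabulate id j) ⟩
    lookup F j                                ≡⟨ Maybeₚ.map-id (lookup F j) ⟨
    Maybe.map id (lookup F j)                 ≡⟨ Maybeₚ.map-cong (Vecₚ.lookup∘tabulate id) (lookup F j) ⟨
    Maybe.map (lookup (idₚ n)) (lookup F j)   ∎

  ConjPT-∘ₚ : (a b : Perm n) (F G H : PT n) → ConjPT a F G → ConjPT b G H → ConjPT (b ∘ₚ a) F H
  ConjPT-∘ₚ a b F G H aFG bGH j = begin
    lookup H (lookup (b ∘ₚ a) j)                            ≡⟨ cong (lookup H) (lookup-∘ₚ b a j) ⟩
    lookup H (lookup b (lookup a j))                        ≡⟨ bGH _ ⟩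
    Maybe.map (lookup b) (lookup G (lookup a j))            ≡⟨ cong (Maybe.map (lookup b)) (aFG j) ⟩
    Maybe.map (lookup b) (Maybe.map (lookup a) (lookup F j)) ≡⟨ Maybeₚ.map-∘ (lookup F j) ⟨
    Maybe.map (lookup b ∘ lookup a) (lookup F j)            ≡⟨ Maybeₚ.map-cong (lookup-∘ₚ b a) (lookup F j) ⟨
    Maybe.map (lookup (b ∘ₚ a)) (lookup F j)                ∎

  ConjPT-⁻¹ : (a : Perm n) → IsPerm a → {F G : PT n} → ConjPT a F G → ConjPT (a ⁻¹) G F
  ConjPT-⁻¹ a pa {F} {G} aFG i = sym (begin
    Maybe.map (lookup (a ⁻¹)) (lookup G i)
      ≡⟨ cong (Maybe.map (lookup (a ⁻¹)) ∘ lookup G) (lookup-⁻¹ʳ a pa i) ⟨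
    Maybe.map (lookup (a ⁻¹)) (lookup G (lookup a (lookup (a ⁻¹) i)))
      ≡⟨ cong (Maybe.map (lookup (a ⁻¹))) (aFG _) ⟩
    Maybe.map (lookup (a ⁻¹)) (Maybe.map (lookup a) (lookup F (lookup (a ⁻¹) i)))
      ≡⟨ Maybeₚ.map-∘ (lookup F (lookup (a ⁻¹) i)) ⟨
    Maybe.map (lookup (a ⁻¹) ∘ lookup a) (lookup F (lookup (a ⁻¹) i))
      ≡⟨ Maybeₚ.map-cong (lookup-⁻¹ˡ a pa) (lookup F (lookup (a ⁻¹) i)) ⟩
    Maybe.map id (lookup F (lookup (a ⁻¹) i))
      ≡⟨ Maybeₚ.map-id (lookup F (lookup (a ⁻¹) i)) ⟩
    lookup F (lookup (a ⁻¹) i)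
      ∎)

  conj-conj⁻¹ : (ρ g : Perm n) → IsPerm ρ → ρ ∘ₚ (conj ρ g ∘ₚ ρ ⁻¹) ≡ g
  conj-conj⁻¹ ρ g pρ = lookup-ext λ i → begin
    lookup (ρ ∘ₚ (conj ρ g ∘ₚ ρ ⁻¹)) i
      ≡⟨ trans (lookup-∘ₚ ρ (conj ρ g ∘ₚ ρ ⁻¹) i)
               (cong (lookup ρ) (lookup-∘ₚ (conj ρ g) (ρ ⁻¹) i)) ⟩
    lookup ρ (lookup (conj ρ g) (lookup (ρ ⁻¹) i))
      ≡⟨ ConjPerm-conj g ρ pρ _ ⟨
    lookup g (lookup ρ (lookup (ρ ⁻¹) i))
      ≡⟨ cong (lookup g) (lookup-⁻¹ʳ ρ pρ i) ⟩
    lookup g i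
      ∎

  Stabilizes-conj⇔ : (ρ g : Perm n) → IsPerm ρ → (F h : PT n) → ConjPT ρ F h →
                     Stabilizes h g ⇔ Stabilizes F (conj ρ g)
  Stabilizes-conj⇔ ρ g pρ F h ρFh = mk⇔
    (λ gh → ConjPT-∘ₚ (g ∘ₚ ρ) (ρ ⁻¹) F h F (ConjPT-∘ₚ ρ g F h h ρFh gh) h→F)
    (λ cF → subst (Stabilizes h) (conj-conj⁻¹ ρ g pρ)
                  (ConjPT-∘ₚ (conj ρ g ∘ₚ ρ ⁻¹) ρ h F h
                             (ConjPT-∘ₚ (ρ ⁻¹) (conj ρ g) h F F h→F cF) ρFh))
    where
    h→F : ConjPT (ρ ⁻¹) h F
    h→F = ConjPT-⁻¹ ρ pρ {F} {h} ρFh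

  stabilizerSize-nonZero : (F : PT n) → NonZero (stabilizerSize n F)
  stabilizerSize-nonZero F = >-nonZero (subst (_≤ stabilizerSize n F)
    (𝟙-yes (conjPT? (idₚ n) F F) (ConjPT-idₚ F))
    (term≤∑-perms n (idₚ n) idₚ-isPerm (λ s → 𝟙 (conjPT? s F F))))

  ∑-ConjPT-onePoint : (ρ : Perm n) → IsPerm ρ → (F : PT n) (G : PT n → ℕ) →
                      ∑[ h ∈ allPT n ] (𝟙 (conjPT? ρ F h) * G h) ≡ G (act ρ F)
  ∑-ConjPT-onePoint ρ pρ F G = trans
    (∑-cong (allPT n) (λ h → cong (_* G h)
      (𝟙-cong (conjPT? ρ F h) (h ≟ᵗ act ρ F) (ConjPT⇒≡act ρ pρ F h) (λ { refl → ConjPT-act ρ pρ F }))))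
    (∑-enumeration-onePoint _≟ᵗ_ (allPT n) (allPT-isEnumeration n) (act ρ F) G)

  𝟙-InOrbit*stabilizerSize : (F h : PT n) →
    𝟙 (inOrbit? F h) * stabilizerSize n F ≡ ∑[ ρ ∈ perms n ] 𝟙 (conjPT? ρ F h)
  𝟙-InOrbit*stabilizerSize F h with inOrbit? F h
  ... | no h∉orbit = sym (∑-zero-∈ (perms n)
          (λ {ρ} ρ∈ → 𝟙-no (conjPT? ρ F h) (λ ρFh → h∉orbit (lose ρ∈ ρFh))))
  ... | yes h∈orbit with find h∈orbit
  ...   | ρ₀ , ρ₀∈ , ρ₀Fh = begin
    stabilizerSize n F + 0
      ≡⟨ +-identityʳ _ ⟩
    ∑[ s ∈ perms n ] 𝟙 (conjPT? s F F)
      ≡⟨ ∑-perms-cong n (λ s ps → 𝟙-cong (conjPT? s F F) (conjPT? (ρ₀ ∘ₚ s) F h)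
           (λ sFF → ConjPT-∘ₚ s ρ₀ F F h sFF ρ₀Fh)
           (λ ρ₀sFh → subst (Stabilizes F) (⁻¹-∘ₚ-cancelˡ ρ₀ pρ₀ s)
              (ConjPT-∘ₚ (ρ₀ ∘ₚ s) (ρ₀ ⁻¹) F h F ρ₀sFh
                         (ConjPT-⁻¹ ρ₀ pρ₀ {F} {h} ρ₀Fh)))) ⟩
    ∑[ s ∈ perms n ] 𝟙 (conjPT? (ρ₀ ∘ₚ s) F h)
      ≡⟨ ∑-perms-∘ₚˡ n ρ₀ pρ₀ (λ ρ → 𝟙 (conjPT? ρ F h)) ⟩
    ∑[ ρ ∈ perms n ] 𝟙 (conjPT? ρ F h)
      ∎
    where
    pρ₀ : IsPerm ρ₀
    pρ₀ = ∈perms⇒IsPerm ρ₀∈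

  orbit-stabilizer : (F : PT n) (g : Perm n) →
    χo n F g * stabilizerSize n F ≡ ∑[ ρ ∈ perms n ] 𝟙 (conjPT? (conj ρ g) F F)
  orbit-stabilizer F g = begin
    χo n F g * c
      ≡⟨ cong (_* c) (count≡∑𝟙 (λ h → inOrbit? F h ×-dec fixes? h) (allPT n)) ⟩
    ∑[ h ∈ allPT n ] 𝟙 (inOrbit? F h ×-dec fixes? h) * c
      ≡⟨ ∑-*ʳ (allPT n) c (λ h → 𝟙 (inOrbit? F h ×-dec fixes? h)) ⟨
    ∑[ h ∈ allPT n ] (𝟙 (inOrbit? F h ×-dec fixes? h) * c)
      ≡⟨ ∑-cong (allPT n) (λ h → cong (_* c)
           (trans (𝟙-× (inOrbit? F h) (fixes? h) (inOrbit? F h ×-dec fixes? h))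
                  (*-comm (𝟙 (inOrbit? F h)) _))) ⟩
    ∑[ h ∈ allPT n ] (𝟙 (fixes? h) * 𝟙 (inOrbit? F h) * c)
      ≡⟨ ∑-cong (allPT n) (λ h → trans (*-assoc (𝟙 (fixes? h)) _ c)
           (cong (𝟙 (fixes? h) *_) (𝟙-InOrbit*stabilizerSize F h))) ⟩
    ∑[ h ∈ allPT n ] (𝟙 (fixes? h) * ∑[ ρ ∈ perms n ] 𝟙 (conjPT? ρ F h))
      ≡⟨ ∑-cong (allPT n) (λ h → trans (sym (∑-*ˡ (perms n) (𝟙 (fixes? h)) _))
           (∑-cong (perms n) (λ ρ → *-comm (𝟙 (fixes? h)) _))) ⟩
    ∑[ h ∈ allPT n ] ∑[ ρ ∈ perms n ] (𝟙 (conjPT? ρ F h) * 𝟙 (fixes? h))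
      ≡⟨ ∑-swap (allPT n) (perms n) _ ⟩
    ∑[ ρ ∈ perms n ] ∑[ h ∈ allPT n ] (𝟙 (conjPT? ρ F h) * 𝟙 (fixes? h))
      ≡⟨ ∑-perms-cong n (λ ρ pρ → ∑-ConjPT-onePoint ρ pρ F (𝟙 ∘ fixes?)) ⟩
    ∑[ ρ ∈ perms n ] 𝟙 (fixes? (act ρ F))
      ≡⟨ ∑-perms-cong n (λ ρ pρ → 𝟙-cong⇔ (fixes? (act ρ F)) (conjPT? (conj ρ g) F F)
                                    (Stabilizes-conj⇔ ρ g pρ F (act ρ F) (ConjPT-act ρ pρ F))) ⟩
    ∑[ ρ ∈ perms n ] 𝟙 (conjPT? (conj ρ g) F F)
      ∎
    where
    c : ℕ
    c = stabilizerSize n F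
    fixes? : (h : PT n) → Dec (Stabilizes h g)
    fixes? h = conjPT? g h h

-- Block-diagonal permutations

module Blocks (k m : ℕ) where

  split-elim : (P : Fin (k + m) → Set) → (∀ a → P (a ↑ˡ m)) → (∀ b → P (k ↑ʳ b)) → ∀ i → P i
  split-elim P left right i with splitAt k i in eq
  ... | inj₁ a = subst P (Finₚ.splitAt⁻¹-↑ˡ eq) (left a)
  ... | inj₂ b = subst P (Finₚ.splitAt⁻¹-↑ʳ eq) (right b)

  ↑ˡ≢↑ʳ : (a : Fin k) (b : Fin m) → a ↑ˡ m ≢ k ↑ʳ b
  ↑ˡ≢↑ʳ a b eq
    with trans (sym (Finₚ.splitAt-↑ˡ k a m)) (trans (cong (splitAt k) eq) (Finₚ.splitAt-↑ʳ k m b))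
  ... | ()

  lookup-diagPerm-↑ˡ : (y₁ : Perm k) (y₂ : Perm m) (a : Fin k) →
                       lookup (diagPerm y₁ y₂) (a ↑ˡ m) ≡ lookup y₁ a ↑ˡ m
  lookup-diagPerm-↑ˡ y₁ y₂ a = trans (Vecₚ.lookup∘tabulate _ (a ↑ˡ m))
    (cong [ (λ i → lookup y₁ i ↑ˡ m) , (λ j → k ↑ʳ lookup y₂ j) ] (Finₚ.splitAt-↑ˡ k a m))

  lookup-diagPerm-↑ʳ : (y₁ : Perm k) (y₂ : Perm m) (b : Fin m) →
                       lookup (diagPerm y₁ y₂) (k ↑ʳ b) ≡ k ↑ʳ lookup y₂ b
  lookup-diagPerm-↑ʳ y₁ y₂ b = trans (Vecₚ.lookup∘tabulate _ (k ↑ʳ b))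
    (cong [ (λ i → lookup y₁ i ↑ˡ m) , (λ j → k ↑ʳ lookup y₂ j) ] (Finₚ.splitAt-↑ʳ k m b))

  -- Points that w sends across the blocks are mapped to themselves (a junk value).
  leftBlock : Perm (k + m) → Perm k
  leftBlock w = tabulate (λ i → [ id , (λ _ → i) ] (splitAt k (lookup w (i ↑ˡ m))))

  rightBlock : Perm (k + m) → Perm m
  rightBlock w = tabulate (λ j → [ (λ _ → j) , id ] (splitAt k (lookup w (k ↑ʳ j))))

  lookup-leftBlock : (w : Perm (k + m)) {a c : Fin k} → lookup w (a ↑ˡ m) ≡ c ↑ˡ m →
                     lookup (leftBlock w) a ≡ c
  lookup-leftBlock w {a} {c} wa≡c = trans (Vecₚ.lookup∘tabulate _ a)
    (cong [ id , (λ _ → a) ] (trans (cong (splitAt k) wa≡c) (Finₚ.splitAt-↑ˡ k c m)))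

  lookup-rightBlock : (w : Perm (k + m)) {b d : Fin m} → lookup w (k ↑ʳ b) ≡ k ↑ʳ d →
                      lookup (rightBlock w) b ≡ d
  lookup-rightBlock w {b} {d} wb≡d = trans (Vecₚ.lookup∘tabulate _ b)
    (cong [ (λ _ → b) , id ] (trans (cong (splitAt k) wb≡d) (Finₚ.splitAt-↑ʳ k m d)))

  leftBlock-diagPerm : (y₁ : Perm k) (y₂ : Perm m) → leftBlock (diagPerm y₁ y₂) ≡ y₁
  leftBlock-diagPerm y₁ y₂ =
    lookup-ext λ a → lookup-leftBlock (diagPerm y₁ y₂) (lookup-diagPerm-↑ˡ y₁ y₂ a)

  rightBlock-diagPerm : (y₁ : Perm k) (y₂ : Perm m) → rightBlock (diagPerm y₁ y₂) ≡ y₂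
  rightBlock-diagPerm y₁ y₂ =
    lookup-ext λ b → lookup-rightBlock (diagPerm y₁ y₂) (lookup-diagPerm-↑ʳ y₁ y₂ b)

  PreservesLeft : Perm (k + m) → Set
  PreservesLeft w = ∀ a → ∃ λ c → lookup w (a ↑ˡ m) ≡ c ↑ˡ m

  PreservesRight : Perm (k + m) → Set
  PreservesRight w = ∀ b → ∃ λ d → lookup w (k ↑ʳ b) ≡ k ↑ʳ d

  BlockDiagonal : Perm (k + m) → Set
  BlockDiagonal w = w ≡ diagPerm (leftBlock w) (rightBlock w)

  blockDiagonal? : Decidable BlockDiagonal
  blockDiagonal? w = w ≟ᵖ diagPerm (leftBlock w) (rightBlock w)

  diagPerm-blockDiagonal : (y₁ : Perm k) (y₂ : Perm m) → BlockDiagonal (diagPerm y₁ y₂)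
  diagPerm-blockDiagonal y₁ y₂ =
    sym (cong₂ diagPerm (leftBlock-diagPerm y₁ y₂) (rightBlock-diagPerm y₁ y₂))

  preserves⇒blockDiagonal : (w : Perm (k + m)) → PreservesLeft w → PreservesRight w → BlockDiagonal w
  preserves⇒blockDiagonal w left right = lookup-ext (split-elim _
    (λ a → let (c , wa≡c) = left a in
           trans wa≡c (sym (trans (lookup-diagPerm-↑ˡ (leftBlock w) (rightBlock w) a)
                                  (cong (_↑ˡ m) (lookup-leftBlock w wa≡c)))))
    (λ b → let (d , wb≡d) = right b in
           trans wb≡d (sym (trans (lookup-diagPerm-↑ʳ (leftBlock w) (rightBlock w) b)
                                  (cong (k ↑ʳ_) (lookup-rightBlock w wb≡d))))))

  blockDiagonal⇒preservesLeft : (w : Perm (k + m)) → BlockDiagonal w → PreservesLeft w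
  blockDiagonal⇒preservesLeft w w≡ a = _ , trans (cong (λ v → lookup v (a ↑ˡ m)) w≡)
                                                 (lookup-diagPerm-↑ˡ (leftBlock w) (rightBlock w) a)

  blockDiagonal⇒preservesRight : (w : Perm (k + m)) → BlockDiagonal w → PreservesRight w
  blockDiagonal⇒preservesRight w w≡ b = _ , trans (cong (λ v → lookup v (k ↑ʳ b)) w≡)
                                                  (lookup-diagPerm-↑ʳ (leftBlock w) (rightBlock w) b)

  diagPerm-isPerm : (y₁ : Perm k) (y₂ : Perm m) → IsPerm y₁ → IsPerm y₂ → IsPerm (diagPerm y₁ y₂)
  diagPerm-isPerm y₁ y₂ p₁ p₂ = split-elim _
    (λ a → let (c , y₁c≡a) = p₁ a in
           c ↑ˡ m , trans (lookup-diagPerm-↑ˡ y₁ y₂ c) (cong (_↑ˡ m) y₁c≡a))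
    (λ b → let (d , y₂d≡b) = p₂ b in
           k ↑ʳ d , trans (lookup-diagPerm-↑ʳ y₁ y₂ d) (cong (k ↑ʳ_) y₂d≡b))

  diagPerm-isPerm⁻ : (y₁ : Perm k) (y₂ : Perm m) → IsPerm (diagPerm y₁ y₂) → IsPerm y₁ × IsPerm y₂
  diagPerm-isPerm⁻ y₁ y₂ p = left , right
    where
    left : IsPerm y₁
    left a = let (j , dj≡a) = p (a ↑ˡ m) in split-elim
      (λ j → lookup (diagPerm y₁ y₂) j ≡ a ↑ˡ m → ∃ λ c → lookup y₁ c ≡ a)
      (λ c e → c , Finₚ.↑ˡ-injective m _ _ (trans (sym (lookup-diagPerm-↑ˡ y₁ y₂ c)) e))
      (λ d e → ⊥-elim (↑ˡ≢↑ʳ a _ (sym (trans (sym (lookup-diagPerm-↑ʳ y₁ y₂ d)) e)))) j dj≡a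
    right : IsPerm y₂
    right b = let (j , dj≡b) = p (k ↑ʳ b) in split-elim
      (λ j → lookup (diagPerm y₁ y₂) j ≡ k ↑ʳ b → ∃ λ d → lookup y₂ d ≡ b)
      (λ c e → ⊥-elim (↑ˡ≢↑ʳ _ b (trans (sym (lookup-diagPerm-↑ˡ y₁ y₂ c)) e)))
      (λ d e → d , Finₚ.↑ʳ-injective k _ _ (trans (sym (lookup-diagPerm-↑ʳ y₁ y₂ d)) e)) j dj≡b

  blocks-isPerm : (w : Perm (k + m)) → IsPerm w → BlockDiagonal w →
                  IsPerm (leftBlock w) × IsPerm (rightBlock w)
  blocks-isPerm w pw w≡ = diagPerm-isPerm⁻ (leftBlock w) (rightBlock w) (subst IsPerm w≡ pw)

  𝟙-≡diagPerm : (w : Perm (k + m)) → BlockDiagonal w → (y₁ : Perm k) (y₂ : Perm m) →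
                𝟙 (w ≟ᵖ diagPerm y₁ y₂) ≡ 𝟙 (y₁ ≟ᵖ leftBlock w) * 𝟙 (y₂ ≟ᵖ rightBlock w)
  𝟙-≡diagPerm w w≡ y₁ y₂ = trans
    (𝟙-cong (w ≟ᵖ diagPerm y₁ y₂) ((y₁ ≟ᵖ leftBlock w) ×-dec (y₂ ≟ᵖ rightBlock w))
      (λ { refl → sym (leftBlock-diagPerm y₁ y₂) , sym (rightBlock-diagPerm y₁ y₂) })
      (λ { (refl , refl) → w≡ }))
    (𝟙-× (y₁ ≟ᵖ leftBlock w) (y₂ ≟ᵖ rightBlock w) _)

  ∑-diagPerm-onePoint : (w : Perm (k + m)) → IsPerm w → (G : Perm k → Perm m → ℕ) →
    ∑[ y₁ ∈ perms k ] ∑[ y₂ ∈ perms m ] (𝟙 (w ≟ᵖ diagPerm y₁ y₂) * G y₁ y₂) ≡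
    𝟙 (blockDiagonal? w) * G (leftBlock w) (rightBlock w)
  ∑-diagPerm-onePoint w pw G with blockDiagonal? w
  ... | no ¬bd = ∑-zero (perms k) λ y₁ → ∑-zero (perms m) λ y₂ → cong (_* G y₁ y₂)
                   (𝟙-no (w ≟ᵖ diagPerm y₁ y₂) (λ { refl → ¬bd (diagPerm-blockDiagonal y₁ y₂) }))
  ... | yes bd = begin
    ∑[ y₁ ∈ perms k ] ∑[ y₂ ∈ perms m ] (𝟙 (w ≟ᵖ diagPerm y₁ y₂) * G y₁ y₂)
      ≡⟨ ∑-cong (perms k) (λ y₁ → ∑-cong (perms m) (λ y₂ → begin
           𝟙 (w ≟ᵖ diagPerm y₁ y₂) * G y₁ y₂
             ≡⟨ cong (_* G y₁ y₂) (𝟙-≡diagPerm w bd y₁ y₂) ⟩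
           𝟙 (y₁ ≟ᵖ a) * 𝟙 (y₂ ≟ᵖ b) * G y₁ y₂
             ≡⟨ *-assoc (𝟙 (y₁ ≟ᵖ a)) _ _ ⟩
           𝟙 (y₁ ≟ᵖ a) * (𝟙 (y₂ ≟ᵖ b) * G y₁ y₂)
             ∎)) ⟩
    ∑[ y₁ ∈ perms k ] ∑[ y₂ ∈ perms m ] (𝟙 (y₁ ≟ᵖ a) * (𝟙 (y₂ ≟ᵖ b) * G y₁ y₂))
      ≡⟨ ∑-cong (perms k) (λ y₁ → ∑-*ˡ (perms m) (𝟙 (y₁ ≟ᵖ a)) _) ⟩
    ∑[ y₁ ∈ perms k ] (𝟙 (y₁ ≟ᵖ a) * ∑[ y₂ ∈ perms m ] (𝟙 (y₂ ≟ᵖ b) * G y₁ y₂))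
      ≡⟨ ∑-perms-onePoint k a pa (λ y₁ → ∑[ y₂ ∈ perms m ] (𝟙 (y₂ ≟ᵖ b) * G y₁ y₂)) ⟩
    ∑[ y₂ ∈ perms m ] (𝟙 (y₂ ≟ᵖ b) * G a y₂)
      ≡⟨ ∑-perms-onePoint m b pb (G a) ⟩
    G a b
      ≡⟨ *-identityˡ (G a b) ⟨
    1 * G a b
      ∎
    where
    a : Perm k
    a = leftBlock w
    b : Perm m
    b = rightBlock w
    pa : IsPerm a
    pa = proj₁ (blocks-isPerm w pw bd)
    pb : IsPerm b
    pb = proj₂ (blocks-isPerm w pw bd)

  ∑-perms-× : (G : Perm k → Perm m → ℕ) →
    ∑[ y₁ ∈ perms k ] ∑[ y₂ ∈ perms m ] G y₁ y₂ ≡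
    ∑[ w ∈ perms (k + m) ] (𝟙 (blockDiagonal? w) * G (leftBlock w) (rightBlock w))
  ∑-perms-× G = begin
    ∑[ y₁ ∈ perms k ] ∑[ y₂ ∈ perms m ] G y₁ y₂
      ≡⟨ ∑-perms-cong k (λ y₁ p₁ → ∑-perms-cong m (λ y₂ p₂ → sym (∑-perms-onePoint (k + m)
           (diagPerm y₁ y₂) (diagPerm-isPerm y₁ y₂ p₁ p₂) (λ _ → G y₁ y₂)))) ⟩
    ∑[ y₁ ∈ perms k ] ∑[ y₂ ∈ perms m ] ∑[ w ∈ perms (k + m) ] term y₁ y₂ w
      ≡⟨ ∑-cong (perms k) (λ y₁ → ∑-swap (perms m) (perms (k + m)) (term y₁)) ⟩
    ∑[ y₁ ∈ perms k ] ∑[ w ∈ perms (k + m) ] ∑[ y₂ ∈ perms m ] term y₁ y₂ w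
      ≡⟨ ∑-swap (perms k) (perms (k + m)) _ ⟩
    ∑[ w ∈ perms (k + m) ] ∑[ y₁ ∈ perms k ] ∑[ y₂ ∈ perms m ] term y₁ y₂ w
      ≡⟨ ∑-perms-cong (k + m) (λ w pw → ∑-diagPerm-onePoint w pw G) ⟩
    ∑[ w ∈ perms (k + m) ] (𝟙 (blockDiagonal? w) * G (leftBlock w) (rightBlock w))
      ∎
    where
    term : Perm k → Perm m → Perm (k + m) → ℕ
    term y₁ y₂ w = 𝟙 (w ≟ᵖ diagPerm y₁ y₂) * G y₁ y₂

  conj-diagPerm : (u b₁ : Perm k) (v b₂ : Perm m) → IsPerm u → IsPerm v →
                  conj (diagPerm u v) (diagPerm b₁ b₂) ≡ diagPerm (conj u b₁) (conj v b₂)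
  conj-diagPerm u b₁ v b₂ pu pv = sym (ConjPerm⇒≡conj (diagPerm b₁ b₂) (diagPerm u v) _
    (diagPerm-isPerm u v pu pv) (split-elim _
      (λ a → begin
        lookup (diagPerm b₁ b₂) (lookup (diagPerm u v) (a ↑ˡ m))
          ≡⟨ cong (lookup (diagPerm b₁ b₂)) (lookup-diagPerm-↑ˡ u v a) ⟩
        lookup (diagPerm b₁ b₂) (lookup u a ↑ˡ m)
          ≡⟨ lookup-diagPerm-↑ˡ b₁ b₂ (lookup u a) ⟩
        lookup b₁ (lookup u a) ↑ˡ m
          ≡⟨ cong (_↑ˡ m) (ConjPerm-conj b₁ u pu a) ⟩
        lookup u (lookup (conj u b₁) a) ↑ˡ m
          ≡⟨ lookup-diagPerm-↑ˡ u v _ ⟨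
        lookup (diagPerm u v) (lookup (conj u b₁) a ↑ˡ m)
          ≡⟨ cong (lookup (diagPerm u v)) (lookup-diagPerm-↑ˡ (conj u b₁) (conj v b₂) a) ⟨
        lookup (diagPerm u v) (lookup (diagPerm (conj u b₁) (conj v b₂)) (a ↑ˡ m))
          ∎)
      (λ b → begin
        lookup (diagPerm b₁ b₂) (lookup (diagPerm u v) (k ↑ʳ b))
          ≡⟨ cong (lookup (diagPerm b₁ b₂)) (lookup-diagPerm-↑ʳ u v b) ⟩
        lookup (diagPerm b₁ b₂) (k ↑ʳ lookup v b)
          ≡⟨ lookup-diagPerm-↑ʳ b₁ b₂ (lookup v b) ⟩
        k ↑ʳ lookup b₂ (lookup v b)
          ≡⟨ cong (k ↑ʳ_) (ConjPerm-conj b₂ v pv b) ⟩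
        k ↑ʳ lookup v (lookup (conj v b₂) b)
          ≡⟨ lookup-diagPerm-↑ʳ u v _ ⟨
        lookup (diagPerm u v) (k ↑ʳ lookup (conj v b₂) b)
          ≡⟨ cong (lookup (diagPerm u v)) (lookup-diagPerm-↑ʳ (conj u b₁) (conj v b₂) b) ⟨
        lookup (diagPerm u v) (lookup (diagPerm (conj u b₁) (conj v b₂)) (k ↑ʳ b))
          ∎)))

  blockDiagonal-conj⁻ : (u : Perm k) (v : Perm m) (w : Perm (k + m)) → IsPerm u → IsPerm v →
                        BlockDiagonal (conj (diagPerm u v) w) → BlockDiagonal w
  blockDiagonal-conj⁻ u v w pu pv bd = preserves⇒blockDiagonal w left right
    where
    d : Perm (k + m)
    d = diagPerm u v
    w′ : Perm (k + m)
    w′ = conj d w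
    w∘d≡d∘w′ : ConjPerm w d w′
    w∘d≡d∘w′ = ConjPerm-conj w d (diagPerm-isPerm u v pu pv)
    left : PreservesLeft w
    left a with pu a
    ... | a′ , ua′≡a with blockDiagonal⇒preservesLeft w′ bd a′
    ...   | c′ , w′a′≡c′ = lookup u c′ , (begin
      lookup w (a ↑ˡ m)
        ≡⟨ cong (lookup w) (trans (lookup-diagPerm-↑ˡ u v a′) (cong (_↑ˡ m) ua′≡a)) ⟨
      lookup w (lookup d (a′ ↑ˡ m)) ≡⟨ w∘d≡d∘w′ (a′ ↑ˡ m) ⟩
      lookup d (lookup w′ (a′ ↑ˡ m)) ≡⟨ cong (lookup d) w′a′≡c′ ⟩
      lookup d (c′ ↑ˡ m)            ≡⟨ lookup-diagPerm-↑ˡ u v c′ ⟩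
      lookup u c′ ↑ˡ m              ∎)
    right : PreservesRight w
    right b with pv b
    ... | b′ , vb′≡b with blockDiagonal⇒preservesRight w′ bd b′
    ...   | d′ , w′b′≡d′ = lookup v d′ , (begin
      lookup w (k ↑ʳ b)
        ≡⟨ cong (lookup w) (trans (lookup-diagPerm-↑ʳ u v b′) (cong (k ↑ʳ_) vb′≡b)) ⟨
      lookup w (lookup d (k ↑ʳ b′)) ≡⟨ w∘d≡d∘w′ (k ↑ʳ b′) ⟩
      lookup d (lookup w′ (k ↑ʳ b′)) ≡⟨ cong (lookup d) w′b′≡d′ ⟩
      lookup d (k ↑ʳ d′)            ≡⟨ lookup-diagPerm-↑ʳ u v d′ ⟩
      k ↑ʳ lookup v d′              ∎)

transposition : ∀ {n} → Fin n → Fin n → Perm n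
transposition i j = tabulate (PC.transpose i j)

transposition-isPerm : ∀ {n} (i j : Fin n) → IsPerm (transposition i j)
transposition-isPerm i j k =
  PC.transpose j i k , trans (Vecₚ.lookup∘tabulate (PC.transpose i j) _) (PC.transpose-inverse i j)

lookup-transposition-zero : ∀ {n} (i : Fin (suc n)) → lookup (transposition i zero) i ≡ zero
lookup-transposition-zero i =
  trans (Vecₚ.lookup∘tabulate (PC.transpose i zero) i) (PC.transpose-inverse i zero {zero})

∑-perms-lookup-zero≡ : ∀ n (i : Fin (suc n)) →
  ∑[ ρ ∈ perms (suc n) ] 𝟙 (i ≟ᶠ lookup ρ zero) ≡
  ∑[ ρ ∈ perms (suc n) ] 𝟙 (zero ≟ᶠ lookup ρ zero)
∑-perms-lookup-zero≡ n i = trans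
  (∑-perms-cong (suc n) λ ρ _ → 𝟙-cong (i ≟ᶠ lookup ρ zero) (zero ≟ᶠ lookup (t ∘ₚ ρ) zero)
    (λ i≡ρ0 → sym (trans (lookup-∘ₚ t ρ zero)
                         (trans (cong (lookup t) (sym i≡ρ0)) (lookup-transposition-zero i))))
    (λ 0≡tρ0 → IsPerm⇒injective t pt
                 (trans (lookup-transposition-zero i) (trans 0≡tρ0 (lookup-∘ₚ t ρ zero)))))
  (∑-perms-∘ₚˡ (suc n) t pt (λ ρ → 𝟙 (zero ≟ᶠ lookup ρ zero)))
  where
  t : Perm (suc n)
  t = transposition i zero
  pt : IsPerm t
  pt = transposition-isPerm i zero

module _ (n : ℕ) where

  open Blocks 1 n

  fixes-zero⇒blockDiagonal : (ρ : Perm (suc n)) → IsPerm ρ → zero ≡ lookup ρ zero → BlockDiagonal ρ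
  fixes-zero⇒blockDiagonal ρ pρ 0≡ρ0 = preserves⇒blockDiagonal ρ left right
    where
    left : PreservesLeft ρ
    left zero = zero , sym 0≡ρ0
    right : PreservesRight ρ
    right b with lookup ρ (suc b) in ρb≡
    ... | zero  = ⊥-elim (Finₚ.0≢1+n (IsPerm⇒injective ρ pρ (trans (sym 0≡ρ0) (sym ρb≡))))
    ... | suc d = d , refl

  blockDiagonal⇒fixes-zero : (ρ : Perm (suc n)) → BlockDiagonal ρ → zero ≡ lookup ρ zero
  blockDiagonal⇒fixes-zero ρ bd with blockDiagonal⇒preservesLeft ρ bd zero
  ... | zero , ρ0≡0 = sym ρ0≡0

length-perms : ∀ n → length (perms n) ≡ n !
length-perms zero    = refl
length-perms (suc n) = begin
  length (perms (suc n))
    ≡⟨ ∑-one (perms (suc n)) ⟨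
  ∑[ ρ ∈ perms (suc n) ] 1
    ≡⟨ ∑-perms-cong (suc n) (λ ρ _ → sym (allFin-isEnumeration (suc n) (lookup ρ zero))) ⟩
  ∑[ ρ ∈ perms (suc n) ] ∑[ i ∈ allFinList (suc n) ] 𝟙 (i ≟ᶠ lookup ρ zero)
    ≡⟨ ∑-swap (perms (suc n)) (allFinList (suc n)) _ ⟩
  ∑[ i ∈ allFinList (suc n) ] ∑[ ρ ∈ perms (suc n) ] 𝟙 (i ≟ᶠ lookup ρ zero)
    ≡⟨ ∑-cong (allFinList (suc n)) (∑-perms-lookup-zero≡ n) ⟩
  ∑[ i ∈ allFinList (suc n) ] #fixing-zero
    ≡⟨ ∑-const (allFinList (suc n)) #fixing-zero ⟩
  length (allFinList (suc n)) * #fixing-zero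
    ≡⟨ cong₂ _*_ (length-tabulate {n = suc n} id) #fixing-zero≡n! ⟩
  suc n * n !
    ∎
  where
  open Blocks 1 n
  #fixing-zero : ℕ
  #fixing-zero = ∑[ ρ ∈ perms (suc n) ] 𝟙 (zero ≟ᶠ lookup ρ zero)
  #fixing-zero≡n! : #fixing-zero ≡ n !
  #fixing-zero≡n! = begin
    #fixing-zero
      ≡⟨ ∑-perms-cong (suc n) (λ ρ pρ → trans
           (𝟙-cong (zero ≟ᶠ lookup ρ zero) (blockDiagonal? ρ)
                   (fixes-zero⇒blockDiagonal n ρ pρ) (blockDiagonal⇒fixes-zero n ρ))
           (sym (*-identityʳ _))) ⟩
    ∑[ ρ ∈ perms (suc n) ] (𝟙 (blockDiagonal? ρ) * 1)
      ≡⟨ ∑-perms-× (λ _ _ → 1) ⟨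
    ∑[ _ ∈ perms 1 ] ∑[ _ ∈ perms n ] 1
      ≡⟨ +-identityʳ _ ⟩
    ∑[ _ ∈ perms n ] 1
      ≡⟨ ∑-one (perms n) ⟩
    length (perms n)
      ≡⟨ length-perms n ⟩
    n !
      ∎

∑-perms-const : ∀ n c → ∑[ _ ∈ perms n ] c ≡ n ! * c
∑-perms-const n c = trans (∑-const (perms n) c) (cong (_* c) (length-perms n))

-- The stabilizer of diag(σ, τ)

lookup-∘PT : ∀ {n} (F G : PT n) (i : Fin n) → lookup (F ∘PT G) i ≡ (lookup G i >>= lookup F)
lookup-∘PT F G = Vecₚ.lookup∘tabulate (λ i → lookup G i >>= lookup F)

Intertwines : ∀ {a b} → (Fin a → Fin b) → PT a → PT b → Set
Intertwines φ G F = ∀ j → lookup F (φ j) ≡ Maybe.map φ (lookup G j)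

Intertwines-^PT : ∀ {a b} (φ : Fin a → Fin b) (G : PT a) (F : PT b) →
                  Intertwines φ G F → ∀ N → Intertwines φ (G ^PT N) (F ^PT N)
Intertwines-^PT φ G F φGF zero j = trans (Vecₚ.lookup∘tabulate just (φ j))
                                         (cong (Maybe.map φ) (sym (Vecₚ.lookup∘tabulate just j)))
Intertwines-^PT φ G F φGF (suc N) j = begin
  lookup (F ∘PT (F ^PT N)) (φ j)
    ≡⟨ lookup-∘PT F (F ^PT N) (φ j) ⟩
  (lookup (F ^PT N) (φ j) >>= lookup F)
    ≡⟨ cong (_>>= lookup F) (Intertwines-^PT φ G F φGF N j) ⟩
  (Maybe.map φ (lookup (G ^PT N) j) >>= lookup F)
    ≡⟨ map->>= (lookup (G ^PT N) j) ⟩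
  Maybe.map φ (lookup (G ^PT N) j >>= lookup G)
    ≡⟨ cong (Maybe.map φ) (lookup-∘PT G (G ^PT N) j) ⟨
  Maybe.map φ (lookup (G ∘PT (G ^PT N)) j)
    ∎
  where
  map->>= : ∀ x → (Maybe.map φ x >>= lookup F) ≡ Maybe.map φ (x >>= lookup G)
  map->>= nothing  = refl
  map->>= (just i) = φGF i

asPT : ∀ {k} → Vec (Fin k) k → PT k
asPT σ = tabulate (just ∘ lookup σ)

Commutes : ∀ {k} → Vec (Fin k) k → Vec (Fin k) k → Set
Commutes σ y = ∀ i → lookup σ (lookup y i) ≡ lookup y (lookup σ i)

Stabilizes-asPT⇔ : ∀ {k} (σ y : Vec (Fin k) k) → Stabilizes (asPT σ) y ⇔ Commutes σ y
Stabilizes-asPT⇔ σ y = mk⇔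
  (λ yσσ i → Maybeₚ.just-injective (trans (sym (lookup-asPT (lookup y i)))
                                         (trans (yσσ i) (cong (Maybe.map (lookup y)) (lookup-asPT i)))))
  (λ σy≡yσ j → trans (lookup-asPT (lookup y j))
                     (trans (cong just (σy≡yσ j)) (cong (Maybe.map (lookup y)) (sym (lookup-asPT j)))))
  where
  lookup-asPT : ∀ i → lookup (asPT σ) i ≡ just (lookup σ i)
  lookup-asPT = Vecₚ.lookup∘tabulate (just ∘ lookup σ)

module Diag {k m : ℕ} (σ : Vec (Fin k) k) (τ : PT m) where

  open Blocks k m

  f : PT (k + m)
  f = diag σ τ

  private
    entry : Fin k ⊎ Fin m → Maybe (Fin (k + m))
    entry = [ (λ i → just (lookup σ i ↑ˡ m)) , (λ j → Maybe.map (k ↑ʳ_) (lookup τ j)) ]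

  lookup-diag-↑ˡ : ∀ a → lookup f (a ↑ˡ m) ≡ just (lookup σ a ↑ˡ m)
  lookup-diag-↑ˡ a = trans (Vecₚ.lookup∘tabulate _ (a ↑ˡ m)) (cong entry (Finₚ.splitAt-↑ˡ k a m))

  lookup-diag-↑ʳ : Intertwines (k ↑ʳ_) τ f
  lookup-diag-↑ʳ b = trans (Vecₚ.lookup∘tabulate _ (k ↑ʳ b)) (cong entry (Finₚ.splitAt-↑ʳ k m b))

  lookup-diag^-↑ˡ : ∀ N a → ∃ λ c → lookup (f ^PT N) (a ↑ˡ m) ≡ just (c ↑ˡ m)
  lookup-diag^-↑ˡ zero    a = a , Vecₚ.lookup∘tabulate just (a ↑ˡ m)
  lookup-diag^-↑ˡ (suc N) a = let (c , fᴺa≡c) = lookup-diag^-↑ˡ N a in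
    lookup σ c , trans (lookup-∘PT f (f ^PT N) (a ↑ˡ m))
                       (trans (cong (_>>= lookup f) fᴺa≡c) (lookup-diag-↑ˡ c))

  -- Every power of f is defined on the left block, while τ ^PT M is empty; a stabilizer
  -- of f commutes with f ^PT M and so cannot move a point of the left block to the right.
  Stabilizes-diag⇒↑ˡ≢↑ʳ : Nilpotent τ → (ρ : Perm (k + m)) → Stabilizes f ρ →
                          ∀ a b → lookup ρ (a ↑ˡ m) ≢ k ↑ʳ b
  Stabilizes-diag⇒↑ˡ≢↑ʳ (M , τᴹ≡∅) ρ ρff a b ρa≡b with lookup-diag^-↑ˡ M a
  ... | c , fᴹa≡c = just≢nothing (begin
    just (lookup ρ (c ↑ˡ m))
      ≡⟨ cong (Maybe.map (lookup ρ)) fᴹa≡c ⟨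
    Maybe.map (lookup ρ) (lookup (f ^PT M) (a ↑ˡ m))
      ≡⟨ Intertwines-^PT (lookup ρ) f f ρff M (a ↑ˡ m) ⟨
    lookup (f ^PT M) (lookup ρ (a ↑ˡ m))
      ≡⟨ cong (lookup (f ^PT M)) ρa≡b ⟩
    lookup (f ^PT M) (k ↑ʳ b)
      ≡⟨ Intertwines-^PT (k ↑ʳ_) τ f lookup-diag-↑ʳ M b ⟩
    Maybe.map (k ↑ʳ_) (lookup (τ ^PT M) b)
      ≡⟨ cong (λ v → Maybe.map (k ↑ʳ_) (lookup v b)) τᴹ≡∅ ⟩
    Maybe.map (k ↑ʳ_) (lookup (emptyPT m) b)
      ≡⟨ cong (Maybe.map (k ↑ʳ_)) (Vecₚ.lookup-replicate b nothing) ⟩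
    nothing
      ∎)
    where
    just≢nothing : ∀ {x : Fin (k + m)} → just x ≢ nothing
    just≢nothing ()

  Stabilizes-diag⇒blockDiagonal : Nilpotent τ → (ρ : Perm (k + m)) → IsPerm ρ → Stabilizes f ρ →
                                  BlockDiagonal ρ
  Stabilizes-diag⇒blockDiagonal nil ρ pρ ρff = preserves⇒blockDiagonal ρ left right
    where
    left : PreservesLeft ρ
    left a with splitAt k (lookup ρ (a ↑ˡ m)) in eq
    ... | inj₁ c = c , sym (Finₚ.splitAt⁻¹-↑ˡ eq)
    ... | inj₂ b = ⊥-elim (Stabilizes-diag⇒↑ˡ≢↑ʳ nil ρ ρff a b (sym (Finₚ.splitAt⁻¹-↑ʳ eq)))
    right : PreservesRight ρ
    right b with splitAt k (lookup ρ (k ↑ʳ b)) in eq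
    ... | inj₂ d = d , sym (Finₚ.splitAt⁻¹-↑ʳ eq)
    ... | inj₁ c = ⊥-elim (Stabilizes-diag⇒↑ˡ≢↑ʳ nil (ρ ⁻¹) (ConjPT-⁻¹ ρ pρ {f} {f} ρff) c b
                     (trans (cong (lookup (ρ ⁻¹)) (Finₚ.splitAt⁻¹-↑ˡ eq)) (lookup-⁻¹ˡ ρ pρ _)))

  module _ (a : Perm k) (b : Perm m) where

    private
      d : Perm (k + m)
      d = diagPerm a b

    f∘diagPerm-↑ˡ : ∀ i → lookup f (lookup d (i ↑ˡ m)) ≡ just (lookup σ (lookup a i) ↑ˡ m)
    f∘diagPerm-↑ˡ i = trans (cong (lookup f) (lookup-diagPerm-↑ˡ a b i)) (lookup-diag-↑ˡ (lookup a i))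

    diagPerm∘f-↑ˡ : ∀ i → Maybe.map (lookup d) (lookup f (i ↑ˡ m)) ≡ just (lookup a (lookup σ i) ↑ˡ m)
    diagPerm∘f-↑ˡ i = trans (cong (Maybe.map (lookup d)) (lookup-diag-↑ˡ i))
                            (cong just (lookup-diagPerm-↑ˡ a b (lookup σ i)))

    f∘diagPerm-↑ʳ : ∀ j → lookup f (lookup d (k ↑ʳ j)) ≡ Maybe.map (k ↑ʳ_) (lookup τ (lookup b j))
    f∘diagPerm-↑ʳ j = trans (cong (lookup f) (lookup-diagPerm-↑ʳ a b j)) (lookup-diag-↑ʳ (lookup b j))

    diagPerm∘f-↑ʳ : ∀ j → Maybe.map (lookup d) (lookup f (k ↑ʳ j)) ≡
                          Maybe.map (k ↑ʳ_) (Maybe.map (lookup b) (lookup τ j))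
    diagPerm∘f-↑ʳ j = begin
      Maybe.map (lookup d) (lookup f (k ↑ʳ j))
        ≡⟨ cong (Maybe.map (lookup d)) (lookup-diag-↑ʳ j) ⟩
      Maybe.map (lookup d) (Maybe.map (k ↑ʳ_) (lookup τ j))
        ≡⟨ Maybeₚ.map-∘ (lookup τ j) ⟨
      Maybe.map (lookup d ∘ (k ↑ʳ_)) (lookup τ j)
        ≡⟨ Maybeₚ.map-cong (lookup-diagPerm-↑ʳ a b) (lookup τ j) ⟩
      Maybe.map ((k ↑ʳ_) ∘ lookup b) (lookup τ j)
        ≡⟨ Maybeₚ.map-∘ (lookup τ j) ⟩
      Maybe.map (k ↑ʳ_) (Maybe.map (lookup b) (lookup τ j))
        ∎

    Stabilizes-diag⇔ : Stabilizes f d ⇔ (Commutes σ a × Stabilizes τ b)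
    Stabilizes-diag⇔ = mk⇔
      (λ dff → (λ i → Finₚ.↑ˡ-injective m _ _ (Maybeₚ.just-injective
                 (trans (sym (f∘diagPerm-↑ˡ i)) (trans (dff (i ↑ˡ m)) (diagPerm∘f-↑ˡ i))))) ,
               (λ j → Maybeₚ.map-injective (Finₚ.↑ʳ-injective k _ _)
                 (trans (sym (f∘diagPerm-↑ʳ j)) (trans (dff (k ↑ʳ j)) (diagPerm∘f-↑ʳ j)))))
      (λ (σa≡aσ , bττ) → split-elim _
        (λ i → trans (f∘diagPerm-↑ˡ i)
                     (trans (cong (λ c → just (c ↑ˡ m)) (σa≡aσ i)) (sym (diagPerm∘f-↑ˡ i))))
        (λ j → trans (f∘diagPerm-↑ʳ j)
                     (trans (cong (Maybe.map (k ↑ʳ_)) (bττ j)) (sym (diagPerm∘f-↑ʳ j)))))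

*-div-cancelʳ : ∀ a d .{{_ : NonZero d}} → (a * d) div d ≡ a
*-div-cancelʳ a (suc d) = m*n/n≡m a (suc d)

module _ {k : ℕ} (σ : Vec (Fin k) k) where

  private
    σ̂ : PT k
    σ̂ = asPT σ

  χInd-centralizer : (y : Perm k) → IsPerm y → χInd k (centralizer? σ) y ≡ χo k σ̂ y
  χInd-centralizer y py = begin
    count conjugatesInto? (perms k) div count (centralizer? σ) (perms k)
      ≡⟨ cong₂ _div_ numerator denominator ⟩
    (χo k σ̂ y * stabilizerSize k σ̂) div stabilizerSize k σ̂
      ≡⟨ *-div-cancelʳ (χo k σ̂ y) (stabilizerSize k σ̂) {{stabilizerSize-nonZero σ̂}} ⟩
    χo k σ̂ y
      ∎
    where
    centralizer⇔ : ∀ x → IsPerm x → Centralizer σ x ⇔ Stabilizes σ̂ x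
    centralizer⇔ x px = mk⇔ (Equivalence.from (Stabilizes-asPT⇔ σ x) ∘ proj₂)
                            (λ xσσ → px , Equivalence.to (Stabilizes-asPT⇔ σ x) xσσ)
    conjugatesInto? : Decidable (λ x → Any (λ z → Centralizer σ z × ConjPerm y x z) (perms k))
    conjugatesInto? x = any? (λ z → centralizer? σ z ×-dec conjPerm? y x z) (perms k)
    denominator : count (centralizer? σ) (perms k) ≡ stabilizerSize k σ̂
    denominator = trans (count≡∑𝟙 (centralizer? σ) (perms k)) (∑-perms-cong k λ x px →
      𝟙-cong⇔ (centralizer? σ x) (conjPT? x σ̂ σ̂) (centralizer⇔ x px))
    numerator : count conjugatesInto? (perms k) ≡ χo k σ̂ y * stabilizerSize k σ̂
    numerator = trans (count≡∑𝟙 conjugatesInto? (perms k)) (trans (∑-perms-cong k λ x px →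
      𝟙-cong (conjugatesInto? x) (conjPT? (conj x y) σ̂ σ̂)
        (λ ∃z → let (z , _ , (z-cent , yx≡xz)) = find ∃z in
                subst (Stabilizes σ̂) (ConjPerm⇒≡conj y x z px yx≡xz)
                      (Equivalence.to (centralizer⇔ z (proj₁ z-cent)) z-cent))
        (λ stab → let pconj = conj-isPerm x y px py in
                  lose (IsPerm⇒∈perms {x = conj x y} pconj)
                       (Equivalence.from (centralizer⇔ (conj x y) pconj) stab , ConjPerm-conj y x px)))
      (sym (orbit-stabilizer σ̂ y)))

module _ {k m : ℕ} (σ : Vec (Fin k) k) (τ : PT m) (nil : Nilpotent τ) where

  open Blocks k m
  open Diag σ τ

  private
    σ̂ : PT k
    σ̂ = asPT σ
    c₁ c₂ : ℕ
    c₁ = stabilizerSize k σ̂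
    c₂ = stabilizerSize m τ

  𝟙-Stabilizes-diagPerm : (a : Perm k) (b : Perm m) →
    𝟙 (conjPT? (diagPerm a b) f f) ≡ 𝟙 (conjPT? a σ̂ σ̂) * 𝟙 (conjPT? b τ τ)
  𝟙-Stabilizes-diagPerm a b = trans
    (𝟙-cong (conjPT? (diagPerm a b) f f) (conjPT? a σ̂ σ̂ ×-dec conjPT? b τ τ)
      (λ dff → let (σa≡aσ , bττ) = Equivalence.to (Stabilizes-diag⇔ a b) dff in
               Equivalence.from (Stabilizes-asPT⇔ σ a) σa≡aσ , bττ)
      (λ (aσσ , bττ) → Equivalence.from (Stabilizes-diag⇔ a b)
                                         (Equivalence.to (Stabilizes-asPT⇔ σ a) aσσ , bττ)))
    (𝟙-× (conjPT? a σ̂ σ̂) (conjPT? b τ τ) _)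

  stabilizerSize-diag : stabilizerSize (k + m) f ≡ c₁ * c₂
  stabilizerSize-diag = begin
    ∑[ s ∈ perms (k + m) ] 𝟙 (conjPT? s f f)
      ≡⟨ ∑-perms-cong (k + m) 𝟙-Stabilizes-diag ⟩
    ∑[ s ∈ perms (k + m) ] (𝟙 (blockDiagonal? s) * Stab₁₂ (leftBlock s) (rightBlock s))
      ≡⟨ ∑-perms-× Stab₁₂ ⟨
    ∑[ a ∈ perms k ] ∑[ b ∈ perms m ] Stab₁₂ a b
      ≡⟨ ∑*∑ (perms k) (perms m) (λ a → 𝟙 (conjPT? a σ̂ σ̂)) (λ b → 𝟙 (conjPT? b τ τ)) ⟨
    c₁ * c₂
      ∎
    where
    Stab₁₂ : Perm k → Perm m → ℕ
    Stab₁₂ a b = 𝟙 (conjPT? a σ̂ σ̂) * 𝟙 (conjPT? b τ τ)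
    𝟙-Stabilizes-diag : ∀ s → IsPerm s →
      𝟙 (conjPT? s f f) ≡ 𝟙 (blockDiagonal? s) * Stab₁₂ (leftBlock s) (rightBlock s)
    𝟙-Stabilizes-diag s ps with blockDiagonal? s
    ... | no ¬bd = 𝟙-no (conjPT? s f f) (¬bd ∘ Stabilizes-diag⇒blockDiagonal nil s ps)
    ... | yes bd = trans (cong (λ s → 𝟙 (conjPT? s f f)) bd)
                         (trans (𝟙-Stabilizes-diagPerm (leftBlock s) (rightBlock s)) (sym (+-identityʳ _)))

  module _ (g : Perm (k + m)) (pg : IsPerm g) where

    private
      α : Perm k → ℕ
      α = χInd k (centralizer? σ)
      β : Perm m → ℕ
      β = χo m τ
      T : ℕ
      T = ∑[ ρ ∈ perms (k + m) ] 𝟙 (conjPT? (conj ρ g) f f)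
      inStab : Perm (k + m) → Perm k → Perm m → ℕ
      inStab x u v = 𝟙 (conjPT? (conj (x ∘ₚ diagPerm u v) g) f f)
      blockWeight : Perm (k + m) → ℕ
      blockWeight x = 𝟙 (blockDiagonal? (conj x g)) * (α (leftBlock (conj x g)) * β (rightBlock (conj x g)))

    indProd-numerator : ℕ
    indProd-numerator =
      ∑[ x ∈ perms (k + m) ] ∑[ y₁ ∈ perms k ] ∑[ y₂ ∈ perms m ]
        (if does (conjPerm? g x (diagPerm y₁ y₂)) then α y₁ * β y₂ else 0)

    indProd≡ : indProd k m α β g ≡ indProd-numerator div (k ! * m !)
    indProd≡ = cong (_div (k ! * m !)) (trans (sum-map≡∑ (perms (k + m)) _)
      (∑-cong (perms (k + m)) λ x → trans (sum-map≡∑ (perms k) _)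
        (∑-cong (perms k) λ y₁ → sum-map≡∑ (perms m) _)))

    indProd-numerator-blockDiagonal : indProd-numerator ≡ ∑ (perms (k + m)) blockWeight
    indProd-numerator-blockDiagonal = ∑-perms-cong (k + m) λ x px → trans
      (∑-cong (perms k) λ y₁ → ∑-cong (perms m) λ y₂ →
        trans (if-does≡𝟙* (conjPerm? g x (diagPerm y₁ y₂)) (α y₁ * β y₂))
              (cong (_* (α y₁ * β y₂))
                    (𝟙-cong (conjPerm? g x (diagPerm y₁ y₂)) (conj x g ≟ᵖ diagPerm y₁ y₂)
                (sym ∘ ConjPerm⇒≡conj g x _ px)
                (λ x⁻¹gx≡ → subst (ConjPerm g x) x⁻¹gx≡ (ConjPerm-conj g x px)))))
      (∑-diagPerm-onePoint (conj x g) (conj-isPerm x g px pg) (λ y₁ y₂ → α y₁ * β y₂))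

    α*c₁ : (b₁ : Perm k) → IsPerm b₁ → α b₁ * c₁ ≡ ∑[ u ∈ perms k ] 𝟙 (conjPT? (conj u b₁) σ̂ σ̂)
    α*c₁ b₁ pb₁ = trans (cong (_* c₁) (χInd-centralizer σ b₁ pb₁)) (orbit-stabilizer σ̂ b₁)

    weighted-term : (x : Perm (k + m)) → IsPerm x →
      blockWeight x * (c₁ * c₂) ≡ ∑[ u ∈ perms k ] ∑[ v ∈ perms m ] inStab x u v
    weighted-term x px with blockDiagonal? (conj x g)
    ... | no ¬bd = sym (∑-perms-zero k λ u pu → ∑-perms-zero m λ v pv →
            𝟙-no (conjPT? (conj (x ∘ₚ diagPerm u v) g) f f) (¬bd ∘ unblock u v pu pv))
      where
      unblock : ∀ u v → IsPerm u → IsPerm v →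
                Stabilizes f (conj (x ∘ₚ diagPerm u v) g) → BlockDiagonal (conj x g)
      unblock u v pu pv stab = blockDiagonal-conj⁻ u v (conj x g) pu pv
        (subst BlockDiagonal (sym (conj-∘ₚ x (diagPerm u v) g px pd))
               (Stabilizes-diag⇒blockDiagonal nil _ pconj stab))
        where
        pd : IsPerm (diagPerm u v)
        pd = diagPerm-isPerm u v pu pv
        pconj : IsPerm (conj (x ∘ₚ diagPerm u v) g)
        pconj = conj-isPerm (x ∘ₚ diagPerm u v) g (∘ₚ-isPerm x (diagPerm u v) px pd) pg
    ... | yes bd = begin
      (α b₁ * β b₂ + 0) * (c₁ * c₂)
        ≡⟨ cong (_* (c₁ * c₂)) (+-identityʳ (α b₁ * β b₂)) ⟩
      α b₁ * β b₂ * (c₁ * c₂)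
        ≡⟨ *-interchange (α b₁) (β b₂) c₁ c₂ ⟩
      α b₁ * c₁ * (β b₂ * c₂)
        ≡⟨ cong₂ _*_ (α*c₁ b₁ pb₁) (orbit-stabilizer τ b₂) ⟩
      ∑[ u ∈ perms k ] 𝟙 (conjPT? (conj u b₁) σ̂ σ̂) * ∑[ v ∈ perms m ] 𝟙 (conjPT? (conj v b₂) τ τ)
        ≡⟨ ∑*∑ (perms k) (perms m) _ _ ⟩
      ∑[ u ∈ perms k ] ∑[ v ∈ perms m ] (𝟙 (conjPT? (conj u b₁) σ̂ σ̂) * 𝟙 (conjPT? (conj v b₂) τ τ))
        ≡⟨ ∑-perms-cong k (λ u pu → ∑-perms-cong m (λ v pv →
             trans (sym (𝟙-Stabilizes-diagPerm (conj u b₁) (conj v b₂)))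
                   (cong (λ s → 𝟙 (conjPT? s f f)) (conj-diagPerm≡ u v pu pv)))) ⟩
      ∑[ u ∈ perms k ] ∑[ v ∈ perms m ] inStab x u v
        ∎
      where
      b₁ : Perm k
      b₁ = leftBlock (conj x g)
      b₂ : Perm m
      b₂ = rightBlock (conj x g)
      pb₁ : IsPerm b₁
      pb₁ = proj₁ (blocks-isPerm (conj x g) (conj-isPerm x g px pg) bd)
      pb₂ : IsPerm b₂
      pb₂ = proj₂ (blocks-isPerm (conj x g) (conj-isPerm x g px pg) bd)
      conj-diagPerm≡ : ∀ u v → IsPerm u → IsPerm v →
                       diagPerm (conj u b₁) (conj v b₂) ≡ conj (x ∘ₚ diagPerm u v) g
      conj-diagPerm≡ u v pu pv = begin
        diagPerm (conj u b₁) (conj v b₂)       ≡⟨ conj-diagPerm u b₁ v b₂ pu pv ⟨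
        conj (diagPerm u v) (diagPerm b₁ b₂)   ≡⟨ cong (conj (diagPerm u v)) bd ⟨
        conj (diagPerm u v) (conj x g)         ≡⟨ conj-∘ₚ x (diagPerm u v) g px (diagPerm-isPerm u v pu pv) ⟩
        conj (x ∘ₚ diagPerm u v) g             ∎

    indProd-numerator*stabilizers : indProd-numerator * (c₁ * c₂) ≡ k ! * (m ! * T)
    indProd-numerator*stabilizers = begin
      indProd-numerator * (c₁ * c₂)
        ≡⟨ cong (_* (c₁ * c₂)) indProd-numerator-blockDiagonal ⟩
      ∑ (perms (k + m)) blockWeight * (c₁ * c₂)
        ≡⟨ ∑-*ʳ (perms (k + m)) (c₁ * c₂) blockWeight ⟨
      ∑[ x ∈ perms (k + m) ] (blockWeight x * (c₁ * c₂))
        ≡⟨ ∑-perms-cong (k + m) weighted-term ⟩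
      ∑[ x ∈ perms (k + m) ] ∑[ u ∈ perms k ] ∑[ v ∈ perms m ] inStab x u v
        ≡⟨ ∑-swap (perms (k + m)) (perms k) _ ⟩
      ∑[ u ∈ perms k ] ∑[ x ∈ perms (k + m) ] ∑[ v ∈ perms m ] inStab x u v
        ≡⟨ ∑-cong (perms k) (λ u → ∑-swap (perms (k + m)) (perms m) (λ x v → inStab x u v)) ⟩
      ∑[ u ∈ perms k ] ∑[ v ∈ perms m ] ∑[ x ∈ perms (k + m) ] inStab x u v
        ≡⟨ ∑-perms-cong k (λ u pu → ∑-perms-cong m (λ v pv → ∑-perms-∘ₚʳ (k + m) (diagPerm u v)
             (diagPerm-isPerm u v pu pv) (λ ρ → 𝟙 (conjPT? (conj ρ g) f f)))) ⟩
      ∑[ u ∈ perms k ] ∑[ v ∈ perms m ] T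
        ≡⟨ ∑-cong (perms k) (λ _ → ∑-perms-const m T) ⟩
      ∑[ u ∈ perms k ] (m ! * T)
        ≡⟨ ∑-perms-const k (m ! * T) ⟩
      k ! * (m ! * T)
        ∎

    indProd-numerator≡ : indProd-numerator ≡ χo (k + m) f g * (k ! * m !)
    indProd-numerator≡ = *-cancelʳ-≡ _ _ (stabilizerSize (k + m) f) {{stabilizerSize-nonZero f}} (begin
      indProd-numerator * stabilizerSize (k + m) f
        ≡⟨ cong (indProd-numerator *_) stabilizerSize-diag ⟩
      indProd-numerator * (c₁ * c₂)
        ≡⟨ indProd-numerator*stabilizers ⟩
      k ! * (m ! * T)
        ≡⟨ cong (λ t → k ! * (m ! * t)) (orbit-stabilizer f g) ⟨
      k ! * (m ! * (χo (k + m) f g * stabilizerSize (k + m) f))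
        ≡⟨ solve 4 (λ a b x c → a :* (b :* (x :* c)) := x :* (a :* b) :* c) refl
                 (k !) (m !) (χo (k + m) f g) (stabilizerSize (k + m) f) ⟩
      χo (k + m) f g * (k ! * m !) * stabilizerSize (k + m) f
        ∎)
      where open +-*-Solver

lemma4p1 : (k m : ℕ) (σ : Vec (Fin k) k) → IsPerm σ →
    (τ : PT m) → Nilpotent τ →
    (g : Vec (Fin (k + m)) (k + m)) → IsPerm g →
    χo (k + m) (diag σ τ) g ≡ indProd k m (χInd k (centralizer? σ)) (χo m τ) g
lemma4p1 k m σ _ τ nil g pg = begin
  χo (k + m) (diag σ τ) g
    ≡⟨ *-div-cancelʳ _ (k ! * m !) {{k !* m !≢0}} ⟨
  (χo (k + m) (diag σ τ) g * (k ! * m !)) div (k ! * m !)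
    ≡⟨ cong (_div (k ! * m !)) (indProd-numerator≡ σ τ nil g pg) ⟨
  indProd-numerator σ τ nil g pg div (k ! * m !)
    ≡⟨ indProd≡ σ τ nil g pg ⟨
  indProd k m (χInd k (centralizer? σ)) (χo m τ) g
    ∎
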